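{- Let $P$ be a finite graded bounded poset. Then the $\chi$-Chow polynomial $\mathrm{H}_P(x)$ of $P$ has non-negative coefficients and is unimodal.
   Context: For a finite graded bounded poset $P$ with rank function $\rho$ ($\rho_{st}=\rho(t)-\rho(s)$), the characteristic function is $\chi_{st}(x)=\sum_{s\le w\le t}\mu_{sw}x^{\rho_{wt}}$ (Möbius function $\mu$), an element of the incidence algebra (maps $[s,t]\mapsto a_{st}(x)\in\mathbb{Z}[x]$ with product $(ab)_{st}=\sum_{s\le w\le t}a_{sw}b_{wt}$). For $s<t$, $\chi_{st}$ is divisible by $x-1$; let $\overline{\chi}_{st}=\chi_{st}/(x-1)$ for $s<t$ and $\overline{\chi}_{ss}=-1$. The $\chi$-Chow function is $\mathrm{H}=-(\overline{\chi})^{ -1}$ and the $\chi$-Chow polynomial of $P$ is $\mathrm{H}_P=\mathrm{H}_{\widehat0\widehat1}$. A polynomial $a_0+\dots+a_mx^m$ with non-negative coefficients is unimodal if $a_0\le\dots\le a_j\ge\dots\ge a_m$ for some $j$. -}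

module Defs where

open import Data.Nat as ℕ using (ℕ; zero; suc; _∸_)
open import Data.Integer using (ℤ; 0ℤ; 1ℤ; -1ℤ; _+_; _*_; -_; _≤_)
open import Data.Fin using (Fin; zero; suc; _≟_)
open import Data.Bool using (Bool; true; false; if_then_else_; _∧_; not)
open import Data.Product using (_×_; ∃-syntax)
open import Data.Sum using (_⊎_)
open import Relation.Nullary using (¬_)
open import Relation.Nullary.Decidable using (⌊_⌋)
open import Relation.Binary.PropositionalEquality using (_≡_)
open import Relation.Binary.Structures using (IsDecPartialOrder)

sumFin : ∀ {n} → (Fin n → ℤ) → ℤ
sumFin {zero}  f = 0ℤ
sumFin {suc n} f = f zero + sumFin (λ i → f (suc i))

sumUpTo : ℕ → (ℕ → ℤ) → ℤ
sumUpTo zero    f = f 0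
sumUpTo (suc k) f = sumUpTo k f + f (suc k)

-- Polynomials in ℤ[x], represented by their coefficient sequence
-- (coefficient of x^k is  p k ; all polynomials used below have finite support)

Poly : Set
Poly = ℕ → ℤ

0P : Poly
0P _ = 0ℤ

constP : ℤ → Poly
constP c zero    = c
constP c (suc _) = 0ℤ

_+P_ : Poly → Poly → Poly
(p +P q) k = p k + q k

-P_ : Poly → Poly
(-P p) k = - p k

_*P_ : Poly → Poly → Poly
(p *P q) k = sumUpTo k (λ i → p i * q (k ∸ i))

sumFinP : ∀ {n} → (Fin n → Poly) → Poly
sumFinP f k = sumFin (λ i → f i k)

-- Quotient of p by (x - 1), for p with p(1) = 0:
-- if p = (x-1) q then q i = -(p 0 + ... + p i).
divXMinus1 : Poly → Poly
divXMinus1 p i = - sumUpTo i p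

NonNegCoeffs : Poly → Set
NonNegCoeffs p = ∀ k → 0ℤ ≤ p k

Unimodal : Poly → Set
Unimodal p = ∃[ j ] ((∀ i → i ℕ.< j → p i ≤ p (suc i)) × (∀ i → j ℕ.≤ i → p (suc i) ≤ p i))

Covers : ∀ {n} → (Fin n → Fin n → Set) → Fin n → Fin n → Set
Covers _≼_ x y = (x ≼ y) × (¬ (x ≡ y)) × (∀ z → x ≼ z → z ≼ y → (z ≡ x) ⊎ (z ≡ y))

record GradedBoundedPoset : Set₁ where
  field
    n                 : ℕ
    _≼_               : Fin n → Fin n → Set
    isDecPartialOrder : IsDecPartialOrder _≡_ _≼_
    bot top           : Fin n
    bot-least         : ∀ x → bot ≼ x
    top-greatest      : ∀ x → x ≼ top
    ρ                 : Fin n → ℕ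
    ρ-bot             : ρ bot ≡ 0
    ρ-cover           : ∀ x y → Covers _≼_ x y → ρ y ≡ suc (ρ x)

  open IsDecPartialOrder isDecPartialOrder public using () renaming (_≤?_ to _≼?_)

module _ (P : GradedBoundedPoset) where
  open GradedBoundedPoset P

  inInterval : Fin n → Fin n → Fin n → Bool
  inInterval s w t = ⌊ s ≼? w ⌋ ∧ ⌊ w ≼? t ⌋

  inIntervalCO : Fin n → Fin n → Fin n → Bool
  inIntervalCO s w t = inInterval s w t ∧ not ⌊ w ≟ t ⌋

  -- Möbius function, by the recursion μ_ss = 1, μ_st = - Σ_{s ≤ w < t} μ_sw;
  -- the first argument is fuel (recursion depth); fuel n suffices since
  -- every chain in P has fewer than n elements.
  mobiusF : ℕ → Fin n → Fin n → ℤ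
  mobiusF zero    s t = 0ℤ
  mobiusF (suc k) s t =
    if ⌊ s ≟ t ⌋ then 1ℤ
    else if ⌊ s ≼? t ⌋ then - sumFin (λ w → if inIntervalCO s w t then mobiusF k s w else 0ℤ)
    else 0ℤ

  mobius : Fin n → Fin n → ℤ
  mobius = mobiusF n

  chi : Fin n → Fin n → Poly
  chi s t k = sumFin (λ w → if inInterval s w t ∧ ⌊ ρ t ∸ ρ w ℕ.≟ k ⌋ then mobius s w else 0ℤ)

  chiBar : Fin n → Fin n → Poly
  chiBar s t = if ⌊ s ≟ t ⌋ then constP -1ℤ
               else if ⌊ s ≼? t ⌋ then divXMinus1 (chi s t)
               else 0P

  -- inverse b = a⁻¹ in the incidence algebra of an element a with a_ss = -1
  -- (so b_ss = -1), via  Σ_{s≤w≤t} b_sw a_wt = δ_st, i.e.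
  -- b_st = Σ_{s ≤ w < t} b_sw a_wt for s < t.
  invDiagNegOneF : ℕ → (Fin n → Fin n → Poly) → Fin n → Fin n → Poly
  invDiagNegOneF zero    a s t = 0P
  invDiagNegOneF (suc k) a s t =
    if ⌊ s ≟ t ⌋ then constP -1ℤ
    else if ⌊ s ≼? t ⌋ then sumFinP (λ w → if inIntervalCO s w t then (invDiagNegOneF k a s w *P a w t) else 0P)
    else 0P

  chowH : Fin n → Fin n → Poly
  chowH s t = -P (invDiagNegOneF n chiBar s t)

  chowPoly : Poly
  chowPoly = chowH bot top

-- Let ζ be the zeta function of P, μ = ζ⁻¹ its Möbius function and [m] = 1 + x + ⋯ + x^(m-1).
-- Since the sum of μ s u over s ≤ u ≤ t vanishes for s < t, dividing χ by x - 1 gives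
-- χ̄ s t = ∑_{s ≤ u ≤ t} μ s u [ρ t - ρ u].  Writing [m] = 1 + x [m - 1] this says χ̄ = -μ (δ - X)
-- with X w t = x [ρ t - ρ w - 1] for w < t, so H = (δ - X)⁻¹ ζ: H s t is the sum over s ≤ u ≤ t
-- of G s u, the sum over chains s = w₀ < ⋯ < wₖ = u of the products of the x [ρ wᵢ₊₁ - ρ wᵢ - 1].
-- Multiplying by x [m] preserves being symmetric and unimodal (with the centre moved by (m+1)/2),
-- so G s u is symmetric unimodal about (ρ u - ρ s)/2, and for s < t the regrouping
-- H s t = ∑_{s ≤ u ≤ t} G s u [ρ t - ρ u] is a sum of symmetric unimodal polynomials that all have
-- the centre (ρ t - ρ s - 1)/2.

module Submission where

open import Defs
open import Level using (0ℓ)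
open import Function using (_∘_; _$_; _⟨_⟩_; flip; mk⇔)
open import Data.Unit using (tt)
open import Data.Bool using (Bool; T; true; false; if_then_else_; _∧_; not)
open import Data.Bool.Properties using (if-float; ⇔→≡)
open import Data.Empty using (⊥-elim)
open import Data.Product using (_×_; _,_; proj₁; proj₂; ∃-syntax)
open import Data.Sum using (_⊎_; inj₁; inj₂)
open import Data.Nat as ℕ using (ℕ; zero; suc; _∸_; z≤n; s≤s; ⌊_/2⌋)
import Data.Nat.Properties as ℕP
import Data.Nat.Tactic.RingSolver as ℕ-Solver
open import Data.Integer as ℤ using (ℤ; 0ℤ; 1ℤ; -1ℤ; _+_; _*_; -_; _-_; _≤_; +≤+)
import Data.Integer.Properties as ℤP
open import Data.Integer.Tactic.RingSolver using (solve-∀)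
open import Data.Fin using (Fin; zero; suc; _≟_)
open import Data.Fin.Properties using (suc-injective; any?)
open import Data.Fin.Subset using (Subset; _∈_; _⊆_; ∣_∣)
open import Data.Fin.Subset.Properties using (∣p∣≤n; p⊂q⇒∣p∣<∣q∣; x∈p⇒∣p-x∣<∣p∣)
open import Data.Vec using (tabulate)
open import Data.Vec.Properties using (lookup∘tabulate; lookup⇒[]=; []=⇒lookup)
open import Algebra.Bundles using (AbelianGroup)
open import Algebra.Properties.Group (AbelianGroup.group ℤP.+-0-abelianGroup) using (∙-cancelʳ)
open import Relation.Binary using (Rel; Decidable; IsPartialOrder; IsDecPartialOrder; Setoid)
import Relation.Binary.Construct.Flip.EqAndOrd as Flip
open import Relation.Binary.PropositionalEquality
  using (_≡_; _≢_; refl; sym; trans; cong; cong₂; subst; subst₂; _≗_; setoid; _→-setoid_; module ≡-Reasoning)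
open import Relation.Nullary using (Dec; does; yes; no; ¬_; contradiction; ¬?)
open import Relation.Nullary.Decidable using (⌊_⌋; isYes≗does; dec-true; does-⇔; toWitness; _×-dec_)

sumFin-cong : ∀ {n} {f g : Fin n → ℤ} → f ≗ g → sumFin f ≡ sumFin g
sumFin-cong {zero}  f≗g = refl
sumFin-cong {suc n} f≗g = cong₂ _+_ (f≗g zero) (sumFin-cong (f≗g ∘ suc))

sumFin-zero : ∀ {n} {f : Fin n → ℤ} → (∀ i → f i ≡ 0ℤ) → sumFin f ≡ 0ℤ
sumFin-zero {zero}  f≡0 = refl
sumFin-zero {suc n} f≡0 = cong₂ _+_ (f≡0 zero) (sumFin-zero (f≡0 ∘ suc))

sumFin-+ : ∀ {n} (f g : Fin n → ℤ) → sumFin (λ i → f i + g i) ≡ sumFin f + sumFin g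
sumFin-+ {zero}  f g = refl
sumFin-+ {suc n} f g = trans (cong (f zero + g zero +_) (sumFin-+ (f ∘ suc) (g ∘ suc)))
                             (+-interchange (f zero) (g zero) _ _)
  where
  +-interchange : ∀ a b c d → a + b + (c + d) ≡ a + c + (b + d)
  +-interchange = solve-∀

sumFin-*ˡ : ∀ {n} c (f : Fin n → ℤ) → sumFin (λ i → c * f i) ≡ c * sumFin f
sumFin-*ˡ {zero}  c f = sym (ℤP.*-zeroʳ c)
sumFin-*ˡ {suc n} c f = trans (cong (c * f zero +_) (sumFin-*ˡ c (f ∘ suc)))
                              (sym (ℤP.*-distribˡ-+ c (f zero) _))

sumFin-comm : ∀ {m n} (f : Fin m → Fin n → ℤ) →
              sumFin (λ i → sumFin (f i)) ≡ sumFin (λ j → sumFin (λ i → f i j))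
sumFin-comm {zero} {n} f = sym (sumFin-zero {n} (λ _ → refl))
sumFin-comm {suc m} {n} f = trans (cong (sumFin (f zero) +_) (sumFin-comm {m} {n} (f ∘ suc)))
                              (sym (sumFin-+ (f zero) (λ j → sumFin (λ i → f (suc i) j))))

sumFin-pointSupported : ∀ {n} (f : Fin n → ℤ) v → (∀ w → w ≢ v → f w ≡ 0ℤ) → sumFin f ≡ f v
sumFin-pointSupported f zero    f≡0 =
  trans (cong (f zero +_) (sumFin-zero (λ w → f≡0 (suc w) λ ()))) (ℤP.+-identityʳ _)
sumFin-pointSupported f (suc v) f≡0 =
  trans (cong (_+ sumFin (f ∘ suc)) (f≡0 zero λ ()))
        (trans (ℤP.+-identityˡ _)
               (sumFin-pointSupported (f ∘ suc) v (λ w w≢v → f≡0 (suc w) (w≢v ∘ suc-injective))))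

sumFin-at : ∀ {n} (f : Fin n → ℤ) v → sumFin (λ w → if ⌊ w ≟ v ⌋ then f w else 0ℤ) ≡ f v
sumFin-at f v = trans (sumFin-pointSupported _ v off-v) at-v
  where
  off-v : ∀ w → w ≢ v → (if ⌊ w ≟ v ⌋ then f w else 0ℤ) ≡ 0ℤ
  off-v w w≢v with w ≟ v
  ... | yes w≡v = contradiction w≡v w≢v
  ... | no _    = refl
  at-v : (if ⌊ v ≟ v ⌋ then f v else 0ℤ) ≡ f v
  at-v with v ≟ v
  ... | yes _   = refl
  ... | no v≢v  = contradiction refl v≢v

∑⟨_⟩ : ∀ {n} → (Fin n → Bool) → (Fin n → ℤ) → ℤ
∑⟨ b ⟩ f = sumFin (λ w → if b w then f w else 0ℤ)

module _ {n : ℕ} {b : Fin n → Bool} where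

  ∑⟨⟩-cong : ∀ {f g} → (∀ w → b w ≡ true → f w ≡ g w) → ∑⟨ b ⟩ f ≡ ∑⟨ b ⟩ g
  ∑⟨⟩-cong f≡g = sumFin-cong (λ w → masked (b w) (f≡g w))
    where
    masked : ∀ c {x y} → (c ≡ true → x ≡ y) → (if c then x else 0ℤ) ≡ (if c then y else 0ℤ)
    masked true  x≡y = x≡y refl
    masked false _   = refl

  ∑⟨⟩-zero : ∀ {f} → (∀ w → b w ≡ true → f w ≡ 0ℤ) → ∑⟨ b ⟩ f ≡ 0ℤ
  ∑⟨⟩-zero f≡0 = trans (∑⟨⟩-cong f≡0) (sumFin-zero (λ w → masked (b w)))
    where
    masked : ∀ c → (if c then 0ℤ else 0ℤ) ≡ 0ℤ
    masked true  = refl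
    masked false = refl

  ∑⟨⟩-+ : ∀ f g → ∑⟨ b ⟩ (λ w → f w + g w) ≡ ∑⟨ b ⟩ f + ∑⟨ b ⟩ g
  ∑⟨⟩-+ f g = trans (sumFin-cong (λ w → masked (b w))) (sumFin-+ (λ w → if b w then f w else 0ℤ) _)
    where
    masked : ∀ c {x y} → (if c then x + y else 0ℤ) ≡ (if c then x else 0ℤ) + (if c then y else 0ℤ)
    masked true  = refl
    masked false = refl

  ∑⟨⟩-*ˡ : ∀ c f → ∑⟨ b ⟩ (λ w → c * f w) ≡ c * ∑⟨ b ⟩ f
  ∑⟨⟩-*ˡ c f = trans (sumFin-cong (λ w → masked (b w))) (sumFin-*ˡ {n} c _)
    where
    masked : ∀ e {x} → (if e then c * x else 0ℤ) ≡ c * (if e then x else 0ℤ)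
    masked true  = refl
    masked false = sym (ℤP.*-zeroʳ c)

  ∑⟨⟩-neg : ∀ f → ∑⟨ b ⟩ (λ w → - f w) ≡ - ∑⟨ b ⟩ f
  ∑⟨⟩-neg f = begin
    ∑⟨ b ⟩ (λ w → - f w)       ≡⟨ ∑⟨⟩-cong (λ w _ → sym (ℤP.-1*i≡-i (f w))) ⟩
    ∑⟨ b ⟩ (λ w → -1ℤ * f w)   ≡⟨ ∑⟨⟩-*ˡ -1ℤ f ⟩
    -1ℤ * ∑⟨ b ⟩ f             ≡⟨ ℤP.-1*i≡-i _ ⟩
    - ∑⟨ b ⟩ f                 ∎
    where open ≡-Reasoning

  ∑⟨⟩-split : ∀ {v} f → b v ≡ true → ∑⟨ b ⟩ f ≡ f v + ∑⟨ (λ w → b w ∧ not ⌊ w ≟ v ⌋) ⟩ f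
  ∑⟨⟩-split {v} f bv = begin
    ∑⟨ b ⟩ f
      ≡⟨ sumFin-cong pointwise ⟩
    sumFin (λ w → (if ⌊ w ≟ v ⌋ then f w else 0ℤ) + (if b w ∧ not ⌊ w ≟ v ⌋ then f w else 0ℤ))
      ≡⟨ sumFin-+ {n} _ _ ⟩
    sumFin (λ w → if ⌊ w ≟ v ⌋ then f w else 0ℤ) + ∑⟨ (λ w → b w ∧ not ⌊ w ≟ v ⌋) ⟩ f
      ≡⟨ cong (_+ ∑⟨ (λ w → b w ∧ not ⌊ w ≟ v ⌋) ⟩ f) (sumFin-at f v) ⟩
    f v + ∑⟨ (λ w → b w ∧ not ⌊ w ≟ v ⌋) ⟩ f
      ∎
    where
    open ≡-Reasoning
    pointwise : ∀ w → (if b w then f w else 0ℤ)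
                    ≡ (if ⌊ w ≟ v ⌋ then f w else 0ℤ) + (if b w ∧ not ⌊ w ≟ v ⌋ then f w else 0ℤ)
    pointwise w with w ≟ v
    ... | yes refl rewrite bv = sym (ℤP.+-identityʳ (f v))
    ... | no _ with b w
    ...   | true  = sym (ℤP.+-identityˡ (f w))
    ...   | false = refl

∑⟨⟩-comm : ∀ {m n} {a : Fin m → Bool} {b : Fin m → Fin n → Bool} {c : Fin n → Bool} {d : Fin n → Fin m → Bool}
           (f : Fin m → Fin n → ℤ) → (∀ v w → (a v ∧ b v w) ≡ (c w ∧ d w v)) →
           ∑⟨ a ⟩ (λ v → ∑⟨ b v ⟩ (f v)) ≡ ∑⟨ c ⟩ (λ w → ∑⟨ d w ⟩ (λ v → f v w))
∑⟨⟩-comm {a = a} {b} {c} {d} f ab≡cd = begin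
  ∑⟨ a ⟩ (λ v → ∑⟨ b v ⟩ (f v))
    ≡⟨ sumFin-cong (λ v → nested (a v) (b v) (f v)) ⟩
  sumFin (λ v → sumFin (λ w → if a v ∧ b v w then f v w else 0ℤ))
    ≡⟨ sumFin-comm (λ v w → if a v ∧ b v w then f v w else 0ℤ) ⟩
  sumFin (λ w → sumFin (λ v → if a v ∧ b v w then f v w else 0ℤ))
    ≡⟨ sumFin-cong (λ w → sumFin-cong (λ v → cong (if_then f v w else 0ℤ) (ab≡cd v w))) ⟩
  sumFin (λ w → sumFin (λ v → if c w ∧ d w v then f v w else 0ℤ))
    ≡⟨ sumFin-cong (λ w → nested (c w) (d w) (λ v → f v w)) ⟨
  ∑⟨ c ⟩ (λ w → ∑⟨ d w ⟩ (λ v → f v w))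
    ∎
  where
  open ≡-Reasoning
  nested : ∀ {k} x (e : Fin k → Bool) (g : Fin k → ℤ) →
           (if x then ∑⟨ e ⟩ g else 0ℤ) ≡ sumFin (λ w → if x ∧ e w then g w else 0ℤ)
  nested true  e g = refl
  nested {k} false e g = sym (sumFin-zero {k} (λ _ → refl))

sumUpTo-cong : ∀ k {f g : ℕ → ℤ} → (∀ i → i ℕ.≤ k → f i ≡ g i) → sumUpTo k f ≡ sumUpTo k g
sumUpTo-cong zero    f≡g = f≡g 0 z≤n
sumUpTo-cong (suc k) f≡g =
  cong₂ _+_ (sumUpTo-cong k (λ i i≤k → f≡g i (ℕP.m≤n⇒m≤1+n i≤k))) (f≡g (suc k) ℕP.≤-refl)

sumUpTo-zero : ∀ k {f : ℕ → ℤ} → (∀ i → i ℕ.≤ k → f i ≡ 0ℤ) → sumUpTo k f ≡ 0ℤ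
sumUpTo-zero k f≡0 = sumUpTo-cong k f≡0 ⟨ trans ⟩ sumUpTo-const0 k
  where
  sumUpTo-const0 : ∀ k → sumUpTo k (λ _ → 0ℤ) ≡ 0ℤ
  sumUpTo-const0 zero    = refl
  sumUpTo-const0 (suc k) = cong (_+ 0ℤ) (sumUpTo-const0 k)

sumUpTo-*ˡ : ∀ k c (f : ℕ → ℤ) → sumUpTo k (λ i → c * f i) ≡ c * sumUpTo k f
sumUpTo-*ˡ zero    c f = refl
sumUpTo-*ˡ (suc k) c f = trans (cong (_+ c * f (suc k)) (sumUpTo-*ˡ k c f)) (sym (ℤP.*-distribˡ-+ c _ (f (suc k))))

sumUpTo-+ : ∀ k (f g : ℕ → ℤ) → sumUpTo k (λ i → f i + g i) ≡ sumUpTo k f + sumUpTo k g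
sumUpTo-+ zero    f g = refl
sumUpTo-+ (suc k) f g = trans (cong (_+ (f (suc k) + g (suc k))) (sumUpTo-+ k f g))
                              (+-interchange (sumUpTo k f) (sumUpTo k g) (f (suc k)) (g (suc k)))
  where
  +-interchange : ∀ a b c d → a + b + (c + d) ≡ a + c + (b + d)
  +-interchange = solve-∀

sumUpTo-sumFin : ∀ k {n} (f : ℕ → Fin n → ℤ) →
                 sumUpTo k (λ i → sumFin (f i)) ≡ sumFin (λ w → sumUpTo k (λ i → f i w))
sumUpTo-sumFin zero    f = refl
sumUpTo-sumFin (suc k) f = trans (cong (_+ sumFin (f (suc k))) (sumUpTo-sumFin k f))
                                 (sym (sumFin-+ (λ w → sumUpTo k (λ i → f i w)) (f (suc k))))

sumUpTo-∑⟨⟩ : ∀ k {n} {b : Fin n → Bool} (f : ℕ → Fin n → ℤ) →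
              sumUpTo k (λ i → ∑⟨ b ⟩ (f i)) ≡ ∑⟨ b ⟩ (λ w → sumUpTo k (λ i → f i w))
sumUpTo-∑⟨⟩ k {b = b} f =
  trans (sumUpTo-sumFin k (λ i w → if b w then f i w else 0ℤ)) (sumFin-cong (λ w → masked (b w)))
  where
  masked : ∀ e {g : ℕ → ℤ} → sumUpTo k (λ i → if e then g i else 0ℤ) ≡ (if e then sumUpTo k g else 0ℤ)
  masked true  = refl
  masked false = sumUpTo-zero k (λ _ _ → refl)

shift : Poly → Poly
shift p zero    = 0ℤ
shift p (suc k) = p k

qInt : ℕ → Poly
qInt zero    _       = 0ℤ
qInt (suc m) zero    = 1ℤ
qInt (suc m) (suc k) = qInt m k

xPow : ℕ → Poly
xPow m k = if ⌊ m ℕ.≟ k ⌋ then 1ℤ else 0ℤ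

shift-cong : ∀ {p q} → p ≗ q → shift p ≗ shift q
shift-cong p≗q zero    = refl
shift-cong p≗q (suc k) = p≗q k

shift-0P : shift 0P ≗ 0P
shift-0P zero    = refl
shift-0P (suc k) = refl

shift-+P : ∀ p q → shift (p +P q) ≗ shift p +P shift q
shift-+P p q zero    = refl
shift-+P p q (suc k) = refl

*P-congˡ : ∀ {p p′} q → p ≗ p′ → p *P q ≗ p′ *P q
*P-congˡ q p≗p′ k = sumUpTo-cong k (λ i _ → cong (_* q (k ∸ i)) (p≗p′ i))

*P-congʳ : ∀ p {q q′} → q ≗ q′ → p *P q ≗ p *P q′
*P-congʳ p q≗q′ k = sumUpTo-cong k (λ i _ → cong (p i *_) (q≗q′ (k ∸ i)))

*P-zeroʳ : ∀ p → p *P 0P ≗ 0P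
*P-zeroʳ p k = sumUpTo-zero k (λ i _ → ℤP.*-zeroʳ (p i))

*P-identityʳ : ∀ p → p *P constP 1ℤ ≗ p
*P-identityʳ p zero    = ℤP.*-identityʳ (p 0)
*P-identityʳ p (suc k) = begin
  sumUpTo k (λ i → p i * constP 1ℤ (suc k ∸ i)) + p (suc k) * constP 1ℤ (k ∸ k)
    ≡⟨ cong₂ _+_ (sumUpTo-zero k (λ i i≤k → cong (λ j → p i * constP 1ℤ j) (ℕP.+-∸-assoc 1 i≤k)
                                              ⟨ trans ⟩ ℤP.*-zeroʳ (p i)))
                 (cong (λ j → p (suc k) * constP 1ℤ j) (ℕP.n∸n≡0 k)) ⟩
  0ℤ + p (suc k) * 1ℤ
    ≡⟨ ℤP.+-identityˡ _ ⟨ trans ⟩ ℤP.*-identityʳ (p (suc k)) ⟩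
  p (suc k)
    ∎
  where open ≡-Reasoning

*P-shiftʳ : ∀ p q → p *P shift q ≗ shift (p *P q)
*P-shiftʳ p q zero    = ℤP.*-zeroʳ (p 0)
*P-shiftʳ p q (suc k) = begin
  sumUpTo k (λ i → p i * shift q (suc k ∸ i)) + p (suc k) * shift q (k ∸ k)
    ≡⟨ cong₂ _+_ (sumUpTo-cong k (λ i i≤k → cong (λ j → p i * shift q j) (ℕP.+-∸-assoc 1 i≤k)))
                 (cong (λ j → p (suc k) * shift q j) (ℕP.n∸n≡0 k) ⟨ trans ⟩ ℤP.*-zeroʳ (p (suc k))) ⟩
  (p *P q) k + 0ℤ
    ≡⟨ ℤP.+-identityʳ _ ⟩
  (p *P q) k
    ∎
  where open ≡-Reasoning

*P-distribˡ-+P : ∀ p q r → p *P (q +P r) ≗ (p *P q) +P (p *P r)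
*P-distribˡ-+P p q r k = trans (sumUpTo-cong k (λ i _ → ℤP.*-distribˡ-+ (p i) (q (k ∸ i)) (r (k ∸ i))))
                               (sumUpTo-+ k _ _)

*P-negˡ : ∀ p q → (-P p) *P q ≗ -P (p *P q)
*P-negˡ p q k = begin
  sumUpTo k (λ i → - p i * q (k ∸ i))          ≡⟨ sumUpTo-cong k (λ i _ → neg-as-* (p i) (q (k ∸ i))) ⟩
  sumUpTo k (λ i → -1ℤ * (p i * q (k ∸ i)))    ≡⟨ sumUpTo-*ˡ k -1ℤ _ ⟩
  -1ℤ * (p *P q) k                             ≡⟨ ℤP.-1*i≡-i _ ⟩
  - (p *P q) k                                 ∎
  where
  open ≡-Reasoning
  neg-as-* : ∀ a b → - a * b ≡ -1ℤ * (a * b)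
  neg-as-* = solve-∀

*P-qInt-n∸n : ∀ p m → p *P qInt (m ∸ m) ≗ 0P
*P-qInt-n∸n p m k = trans (cong (λ i → (p *P qInt i) k) (ℕP.n∸n≡0 m)) (*P-zeroʳ p k)

qInt-suc : ∀ m → qInt (suc m) ≗ constP 1ℤ +P shift (qInt m)
qInt-suc m zero    = refl
qInt-suc m (suc k) = sym (ℤP.+-identityˡ (qInt m k))

*P-qInt-suc : ∀ p m → p *P qInt (suc m) ≗ p +P shift (p *P qInt m)
*P-qInt-suc p m k = begin
  (p *P qInt (suc m)) k                                 ≡⟨ *P-congʳ p (qInt-suc m) k ⟩
  (p *P (constP 1ℤ +P shift (qInt m))) k                ≡⟨ *P-distribˡ-+P p (constP 1ℤ) (shift (qInt m)) k ⟩
  (p *P constP 1ℤ) k + (p *P shift (qInt m)) k          ≡⟨ cong₂ _+_ (*P-identityʳ p k) (*P-shiftʳ p (qInt m) k) ⟩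
  p k + shift (p *P qInt m) k                           ∎
  where open ≡-Reasoning

*P-∑⟨⟩ : ∀ {n} {b : Fin n → Bool} p (c : Fin n → ℤ) (q : Fin n → Poly) k →
          (p *P (λ j → ∑⟨ b ⟩ (λ w → c w * q w j))) k ≡ ∑⟨ b ⟩ (λ w → c w * (p *P q w) k)
*P-∑⟨⟩ {b = b} p c q k = begin
  sumUpTo k (λ i → p i * ∑⟨ b ⟩ (λ w → c w * q w (k ∸ i)))
    ≡⟨ sumUpTo-cong k (λ i _ → sym (∑⟨⟩-*ˡ {b = b} (p i) (λ w → c w * q w (k ∸ i)))) ⟩
  sumUpTo k (λ i → ∑⟨ b ⟩ (λ w → p i * (c w * q w (k ∸ i))))
    ≡⟨ sumUpTo-∑⟨⟩ k {b = b} (λ i w → p i * (c w * q w (k ∸ i))) ⟩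
  ∑⟨ b ⟩ (λ w → sumUpTo k (λ i → p i * (c w * q w (k ∸ i))))
    ≡⟨ ∑⟨⟩-cong (λ w _ → trans (sumUpTo-cong k (λ i _ → swap (p i) (c w) _)) (sumUpTo-*ˡ k (c w) _)) ⟩
  ∑⟨ b ⟩ (λ w → c w * (p *P q w) k)
    ∎
  where
  open ≡-Reasoning
  swap : ∀ x y z → x * (y * z) ≡ y * (x * z)
  swap = solve-∀

∑⟨⟩-*P : ∀ {n} {b : Fin n → Bool} (c : Fin n → ℤ) (p : Fin n → Poly) q k →
         ((λ i → ∑⟨ b ⟩ (λ w → c w * p w i)) *P q) k ≡ ∑⟨ b ⟩ (λ w → c w * (p w *P q) k)
∑⟨⟩-*P {b = b} c p q k = begin
  sumUpTo k (λ i → ∑⟨ b ⟩ (λ w → c w * p w i) * q (k ∸ i))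
    ≡⟨ sumUpTo-cong k (λ i _ → trans (ℤP.*-comm _ (q (k ∸ i)))
                                     (sym (∑⟨⟩-*ˡ {b = b} (q (k ∸ i)) (λ w → c w * p w i)))) ⟩
  sumUpTo k (λ i → ∑⟨ b ⟩ (λ w → q (k ∸ i) * (c w * p w i)))
    ≡⟨ sumUpTo-∑⟨⟩ k {b = b} (λ i w → q (k ∸ i) * (c w * p w i)) ⟩
  ∑⟨ b ⟩ (λ w → sumUpTo k (λ i → q (k ∸ i) * (c w * p w i)))
    ≡⟨ ∑⟨⟩-cong (λ w _ → trans (sumUpTo-cong k (λ i _ → swap (q (k ∸ i)) (c w) _)) (sumUpTo-*ˡ k (c w) _)) ⟩
  ∑⟨ b ⟩ (λ w → c w * (p w *P q) k)
    ∎
  where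
  open ≡-Reasoning
  swap : ∀ x y z → x * (y * z) ≡ y * (z * x)
  swap = solve-∀

xPow-suc : ∀ m k → xPow (suc m) (suc k) ≡ xPow m k
xPow-suc m k = cong (if_then 1ℤ else 0ℤ) (begin
  ⌊ suc m ℕ.≟ suc k ⌋   ≡⟨ isYes≗does (suc m ℕ.≟ suc k) ⟩
  does (suc m ℕ.≟ suc k) ≡⟨ does-⇔ (mk⇔ ℕP.suc-injective (cong suc)) (suc m ℕ.≟ suc k) (m ℕ.≟ k) ⟩
  does (m ℕ.≟ k)         ≡⟨ isYes≗does (m ℕ.≟ k) ⟨
  ⌊ m ℕ.≟ k ⌋           ∎)
  where open ≡-Reasoning

qInt-step : ∀ m j → qInt m j ≡ xPow m (suc j) + qInt m (suc j)
qInt-step zero          j       = refl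
qInt-step (suc zero)    zero    = refl
qInt-step (suc (suc m)) zero    = refl
qInt-step (suc m)       (suc j) = trans (qInt-step m j) (cong (_+ qInt m (suc j)) (sym (xPow-suc m (suc j))))

-- As divXMinus1 takes negated prefix sums, this says (x^m - 1)/(x - 1) = [m].
xPow-prefixSum : ∀ m j → sumUpTo j (xPow m) ≡ 1ℤ - qInt m j
xPow-prefixSum zero    zero    = refl
xPow-prefixSum (suc m) zero    = refl
xPow-prefixSum m       (suc j) = begin
  sumUpTo j (xPow m) + xPow m (suc j)                           ≡⟨ cong (_+ xPow m (suc j)) (xPow-prefixSum m j) ⟩
  1ℤ - qInt m j + xPow m (suc j)                                ≡⟨ cong (λ q → 1ℤ - q + xPow m (suc j)) (qInt-step m j) ⟩
  1ℤ - (xPow m (suc j) + qInt m (suc j)) + xPow m (suc j)       ≡⟨ cancel (xPow m (suc j)) (qInt m (suc j)) ⟩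
  1ℤ - qInt m (suc j)                                           ∎
  where
  open ≡-Reasoning
  cancel : ∀ a b → 1ℤ - (a + b) + a ≡ 1ℤ - b
  cancel = solve-∀

shiftSum : ℕ → Poly → Poly
shiftSum zero    p = 0P
shiftSum (suc m) p = p +P shift (shiftSum m p)

shiftBy : ℕ → Poly → Poly
shiftBy zero    p = p
shiftBy (suc m) p = shift (shiftBy m p)

*P-qInt : ∀ p m → p *P qInt m ≗ shiftSum m p
*P-qInt p zero    = *P-zeroʳ p
*P-qInt p (suc m) k = trans (*P-qInt-suc p m k) (cong (p k +_) (shift-cong (*P-qInt p m) k))

shiftBy-+ : ∀ m p k → shiftBy m p (m ℕ.+ k) ≡ p k
shiftBy-+ zero    p k = refl
shiftBy-+ (suc m) p k = shiftBy-+ m p k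

shiftBy-< : ∀ {m k} p → k ℕ.< m → shiftBy m p k ≡ 0ℤ
shiftBy-< {suc m} {zero}  p _         = refl
shiftBy-< {suc m} {suc k} p (s≤s k<m) = shiftBy-< p k<m

shiftSum-suc : ∀ m p → shiftSum (suc m) p ≗ shiftSum m p +P shiftBy m p
shiftSum-suc zero    p k = trans (cong (p k +_) (shift-0P k)) (trans (ℤP.+-identityʳ (p k)) (sym (ℤP.+-identityˡ (p k))))
shiftSum-suc (suc m) p k = begin
  p k + shift (shiftSum (suc m) p) k                              ≡⟨ cong (p k +_) (shift-cong (shiftSum-suc m p) k) ⟩
  p k + shift (shiftSum m p +P shiftBy m p) k                     ≡⟨ cong (p k +_) (shift-+P (shiftSum m p) (shiftBy m p) k) ⟩
  p k + (shift (shiftSum m p) k + shiftBy (suc m) p k)            ≡⟨ ℤP.+-assoc (p k) _ _ ⟨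
  p k + shift (shiftSum m p) k + shiftBy (suc m) p k              ∎
  where open ≡-Reasoning

record SymUnimodal (d : ℕ) (p : Poly) : Set where
  field
    nonneg    : ∀ k → 0ℤ ≤ p k
    vanish    : ∀ k → d ℕ.< k → p k ≡ 0ℤ
    symmetric : ∀ i j → i ℕ.+ j ≡ d → p i ≡ p j
    ascending : ∀ k → suc (k ℕ.+ k) ℕ.≤ d → p k ≤ p (suc k)

open SymUnimodal

module _ {d : ℕ} {p : Poly} (su : SymUnimodal d p) where

  ascending-≤ : ∀ {i j} → i ℕ.≤ j → j ℕ.+ j ℕ.≤ d → p i ≤ p j
  ascending-≤ {j = zero}  z≤n _ = ℤP.≤-refl
  ascending-≤ {i} {suc j} i≤1+j 2j+2≤d with ℕP.m≤n⇒m<n∨m≡n i≤1+j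
  ... | inj₂ refl      = ℤP.≤-refl
  ... | inj₁ (s≤s i≤j) =
    ℤP.≤-trans (ascending-≤ i≤j (ℕP.<⇒≤ (ℕP.<⇒≤ 2j+2≤d′))) (ascending su j (ℕP.<⇒≤ 2j+2≤d′))
    where
    2j+2≤d′ : suc (suc (j ℕ.+ j)) ℕ.≤ d
    2j+2≤d′ = subst (ℕ._≤ d) (cong suc (ℕP.+-suc j j)) 2j+2≤d

  ascending-pair : ∀ {i j} → i ℕ.≤ j → i ℕ.+ j ℕ.≤ d → p i ≤ p j
  ascending-pair {i} {j} i≤j i+j≤d with j ℕ.+ j ℕ.≤? d
  ... | yes 2j≤d = ascending-≤ i≤j 2j≤d
  ... | no 2j≰d  = subst (p i ≤_) (symmetric su (d ∸ j) j (ℕP.m∸n+n≡m j≤d)) (ascending-≤ i≤e 2e≤d)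
    where
    j≤d : j ℕ.≤ d
    j≤d = ℕP.≤-trans (ℕP.m≤n+m j i) i+j≤d
    i≤e : i ℕ.≤ d ∸ j
    i≤e = ℕP.m+n≤o⇒m≤o∸n i i+j≤d
    e<j : d ∸ j ℕ.< j
    e<j = ℕP.+-cancelʳ-< j (d ∸ j) j (subst (ℕ._< j ℕ.+ j) (sym (ℕP.m∸n+n≡m j≤d)) (ℕP.≰⇒> 2j≰d))
    2e≤d : (d ∸ j) ℕ.+ (d ∸ j) ℕ.≤ d
    2e≤d = subst ((d ∸ j) ℕ.+ (d ∸ j) ℕ.≤_) (ℕP.m∸n+n≡m j≤d) (ℕP.+-monoʳ-≤ (d ∸ j) (ℕP.<⇒≤ e<j))

  shiftSum-nonneg : ∀ m k → 0ℤ ≤ shiftSum m p k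
  shiftSum-nonneg zero    k       = ℤP.≤-refl
  shiftSum-nonneg (suc m) zero    = ℤP.+-mono-≤ (nonneg su 0) ℤP.≤-refl
  shiftSum-nonneg (suc m) (suc k) = ℤP.+-mono-≤ (nonneg su (suc k)) (shiftSum-nonneg m k)

  shiftSum-vanish : ∀ m k → d ℕ.+ m ℕ.≤ k → shiftSum m p k ≡ 0ℤ
  shiftSum-vanish zero    k       _ = refl
  shiftSum-vanish (suc m) zero    h = contradiction (ℕP.n≤0⇒n≡0 h) (ℕP.m+1+n≢0 d)
  shiftSum-vanish (suc m) (suc k) h =
    cong₂ _+_ (vanish su (suc k) (s≤s (ℕP.≤-trans (ℕP.m≤m+n d m) h′))) (shiftSum-vanish m k h′)
    where
    h′ : d ℕ.+ m ℕ.≤ k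
    h′ = ℕP.≤-pred (subst (ℕ._≤ suc k) (ℕP.+-suc d m) h)

  shiftSum-one : shiftSum 1 p ≗ p
  shiftSum-one k = trans (cong (p k +_) (shift-0P k)) (ℤP.+-identityʳ (p k))

  -- shiftSum (m + 2) p extends shiftSum (m + 1) p by p at the bottom and by x^(m+1) p at the top,
  -- and these two mirror each other about the new centre.
  shiftSum-symmetric : ∀ m i j → i ℕ.+ j ≡ d ℕ.+ m → shiftSum (suc m) p i ≡ shiftSum (suc m) p j
  shiftSum-symmetric zero i j i+j≡d+0 =
    trans (shiftSum-one i) (trans (symmetric su i j (trans i+j≡d+0 (ℕP.+-identityʳ d))) (sym (shiftSum-one j)))
  shiftSum-symmetric (suc m) zero .(d ℕ.+ suc m) refl = begin
    p 0 + 0ℤ                                     ≡⟨ ℤP.+-identityʳ (p 0) ⟩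
    p 0                                          ≡⟨ symmetric su 0 d refl ⟩
    p d                                          ≡⟨ shiftBy-+ (suc m) p d ⟨
    shiftBy (suc m) p (suc m ℕ.+ d)              ≡⟨ cong (shiftBy (suc m) p) (ℕP.+-comm (suc m) d) ⟩
    shiftBy (suc m) p e                          ≡⟨ ℤP.+-identityˡ _ ⟨
    0ℤ + shiftBy (suc m) p e                     ≡⟨ cong (_+ shiftBy (suc m) p e) (shiftSum-vanish (suc m) e ℕP.≤-refl) ⟨
    shiftSum (suc m) p e + shiftBy (suc m) p e   ≡⟨ shiftSum-suc (suc m) p e ⟨
    shiftSum (suc (suc m)) p e                   ∎
    where
    open ≡-Reasoning
    e : ℕ
    e = d ℕ.+ suc m
  shiftSum-symmetric (suc m) (suc i) j 1+i+j≡d+1+m = begin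
    p (suc i) + shiftSum (suc m) p i                 ≡⟨ cong₂ _+_ p[1+i]≡ (shiftSum-symmetric m i j i+j≡d+m) ⟩
    shiftBy (suc m) p j + shiftSum (suc m) p j       ≡⟨ ℤP.+-comm (shiftBy (suc m) p j) _ ⟩
    shiftSum (suc m) p j + shiftBy (suc m) p j       ≡⟨ shiftSum-suc (suc m) p j ⟨
    shiftSum (suc (suc m)) p j                       ∎
    where
    open ≡-Reasoning
    i+j≡d+m : i ℕ.+ j ≡ d ℕ.+ m
    i+j≡d+m = ℕP.suc-injective (trans 1+i+j≡d+1+m (ℕP.+-suc d m))
    p[1+i]≡ : p (suc i) ≡ shiftBy (suc m) p j
    p[1+i]≡ with suc m ℕ.≤? j
    ... | yes 1+m≤j with ℕP.m≤n⇒∃[o]m+o≡n 1+m≤j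
    ...   | f , refl = trans (symmetric su (suc i) f (ℕP.+-cancelʳ-≡ m _ _ (trans (regroup i m f) i+j≡d+m)))
                             (sym (shiftBy-+ (suc m) p f))
      where
      regroup : ∀ i m f → suc i ℕ.+ f ℕ.+ m ≡ i ℕ.+ (suc m ℕ.+ f)
      regroup = ℕ-Solver.solve-∀
    p[1+i]≡ | no 1+m≰j = trans (vanish su (suc i) d<1+i) (sym (shiftBy-< p (ℕP.≰⇒> 1+m≰j)))
      where
      d<1+i : d ℕ.< suc i
      d<1+i = s≤s (ℕP.+-cancelʳ-≤ m d i
                    (subst (ℕ._≤ i ℕ.+ m) i+j≡d+m (ℕP.+-monoʳ-≤ i (ℕP.≤-pred (ℕP.≰⇒> 1+m≰j)))))

  shiftSum-ascending : ∀ m k → suc (k ℕ.+ k) ℕ.≤ d ℕ.+ m → shiftSum (suc m) p k ≤ shiftSum (suc m) p (suc k)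
  shiftSum-ascending m k 2k+1≤d+m = begin
    shiftSum (suc m) p k                   ≡⟨ shiftSum-suc m p k ⟩
    shiftSum m p k + shiftBy m p k         ≤⟨ ℤP.+-monoʳ-≤ (shiftSum m p k) shiftBy≤ ⟩
    shiftSum m p k + p (suc k)             ≡⟨ ℤP.+-comm (shiftSum m p k) _ ⟩
    p (suc k) + shiftSum m p k             ∎
    where
    open ℤP.≤-Reasoning
    shiftBy≤ : shiftBy m p k ≤ p (suc k)
    shiftBy≤ with m ℕ.≤? k
    ... | yes m≤k with ℕP.m≤n⇒∃[o]m+o≡n m≤k
    ...   | f , refl = subst (_≤ p (suc (m ℕ.+ f))) (sym (shiftBy-+ m p f))
                         (ascending-pair (ℕP.≤-trans (ℕP.m≤n+m f m) (ℕP.n≤1+n _))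
                                         (ℕP.+-cancelʳ-≤ m _ d (subst (ℕ._≤ d ℕ.+ m) (regroup m f) 2k+1≤d+m)))
      where
      regroup : ∀ m f → suc (m ℕ.+ f ℕ.+ (m ℕ.+ f)) ≡ f ℕ.+ suc (m ℕ.+ f) ℕ.+ m
      regroup = ℕ-Solver.solve-∀
    shiftBy≤ | no m≰k = subst (_≤ p (suc k)) (sym (shiftBy-< p (ℕP.≰⇒> m≰k))) (nonneg su (suc k))

  symUnimodal-shiftSum : ∀ m → SymUnimodal (d ℕ.+ m) (shiftSum (suc m) p)
  symUnimodal-shiftSum m = record
    { nonneg    = shiftSum-nonneg (suc m)
    ; vanish    = λ k d+m<k → shiftSum-vanish (suc m) k (subst (ℕ._≤ k) (sym (ℕP.+-suc d m)) d+m<k)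
    ; symmetric = shiftSum-symmetric m
    ; ascending = shiftSum-ascending m
    }

symUnimodal-≗ : ∀ {d p q} → p ≗ q → SymUnimodal d p → SymUnimodal d q
symUnimodal-≗ p≗q su = record
  { nonneg    = λ k → subst (0ℤ ≤_) (p≗q k) (nonneg su k)
  ; vanish    = λ k d<k → trans (sym (p≗q k)) (vanish su k d<k)
  ; symmetric = λ i j i+j≡d → trans (sym (p≗q i)) (trans (symmetric su i j i+j≡d) (p≗q j))
  ; ascending = λ k h → subst₂ _≤_ (p≗q k) (p≗q (suc k)) (ascending su k h)
  }

symUnimodal-0P : ∀ {d} → SymUnimodal d 0P
symUnimodal-0P = record
  { nonneg = λ _ → ℤP.≤-refl ; vanish = λ _ _ → refl ; symmetric = λ _ _ _ → refl ; ascending = λ _ _ → ℤP.≤-refl }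

symUnimodal-1 : SymUnimodal 0 (constP 1ℤ)
symUnimodal-1 = record
  { nonneg    = λ { zero → +≤+ z≤n ; (suc _) → ℤP.≤-refl }
  ; vanish    = λ { (suc _) _ → refl }
  ; symmetric = λ { zero zero _ → refl }
  ; ascending = λ _ ()
  }

symUnimodal-+P : ∀ {d p q} → SymUnimodal d p → SymUnimodal d q → SymUnimodal d (p +P q)
symUnimodal-+P sp sq = record
  { nonneg    = λ k → ℤP.+-mono-≤ (nonneg sp k) (nonneg sq k)
  ; vanish    = λ k d<k → cong₂ _+_ (vanish sp k d<k) (vanish sq k d<k)
  ; symmetric = λ i j i+j≡d → cong₂ _+_ (symmetric sp i j i+j≡d) (symmetric sq i j i+j≡d)
  ; ascending = λ k h → ℤP.+-mono-≤ (ascending sp k h) (ascending sq k h)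
  }

symUnimodal-∑⟨⟩ : ∀ {n d} {b : Fin n → Bool} {p : Fin n → Poly} →
                  (∀ w → b w ≡ true → SymUnimodal d (p w)) → SymUnimodal d (λ k → ∑⟨ b ⟩ (λ w → p w k))
symUnimodal-∑⟨⟩ {zero}      _  = symUnimodal-0P
symUnimodal-∑⟨⟩ {suc n} {b = b} sp =
  symUnimodal-+P (masked (b zero) (sp zero)) (symUnimodal-∑⟨⟩ (sp ∘ suc))
  where
  masked : ∀ {d q} e → (e ≡ true → SymUnimodal d q) → SymUnimodal d (λ k → if e then q k else 0ℤ)
  masked true  sq = sq refl
  masked false _  = symUnimodal-0P

symUnimodal-shift : ∀ {d p} → SymUnimodal d p → SymUnimodal (suc (suc d)) (shift p)
symUnimodal-shift {d} {p} su = record { nonneg = nn ; vanish = va ; symmetric = sy ; ascending = as }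
  where
  nn : ∀ k → 0ℤ ≤ shift p k
  nn zero    = ℤP.≤-refl
  nn (suc k) = nonneg su k
  va : ∀ k → suc (suc d) ℕ.< k → shift p k ≡ 0ℤ
  va (suc k) (s≤s 2+d≤k) = vanish su k (ℕP.<⇒≤ 2+d≤k)
  sy : ∀ i j → i ℕ.+ j ≡ suc (suc d) → shift p i ≡ shift p j
  sy zero    j       refl = sym (vanish su (suc d) ℕP.≤-refl)
  sy (suc i) zero    e    =
    vanish su i (ℕP.≤-reflexive (sym (ℕP.suc-injective (trans (sym (ℕP.+-identityʳ (suc i))) e))))
  sy (suc i) (suc j) e    = symmetric su i j (ℕP.suc-injective (trans (sym (ℕP.+-suc i j)) (ℕP.suc-injective e)))
  as : ∀ k → suc (k ℕ.+ k) ℕ.≤ suc (suc d) → shift p k ≤ shift p (suc k)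
  as zero    _       = nonneg su 0
  as (suc k) (s≤s h) = ascending su k (ℕP.≤-pred (subst (ℕ._≤ suc d) (ℕP.+-suc (suc k) k) h))

symUnimodal-*qInt : ∀ {d p} → SymUnimodal d p → ∀ m → SymUnimodal (d ℕ.+ m) (p *P qInt (suc m))
symUnimodal-*qInt {p = p} su m = symUnimodal-≗ (λ k → sym (*P-qInt p (suc m) k)) (symUnimodal-shiftSum su m)

symUnimodal-x*qInt : ∀ {d p} → SymUnimodal d p → ∀ m → SymUnimodal (d ℕ.+ suc m) (shift (p *P qInt m))
symUnimodal-x*qInt {p = p} su zero =
  symUnimodal-≗ (λ k → sym (trans (shift-cong (*P-zeroʳ p) k) (shift-0P k))) symUnimodal-0P
symUnimodal-x*qInt {d} {p} su (suc m) =
  subst (λ e → SymUnimodal e (shift (p *P qInt (suc m))))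
        (sym (trans (ℕP.+-suc d (suc m)) (cong suc (ℕP.+-suc d m))))
        (symUnimodal-shift (symUnimodal-*qInt su m))

⌊n/2⌋+⌊n/2⌋≤n : ∀ n → ⌊ n /2⌋ ℕ.+ ⌊ n /2⌋ ℕ.≤ n
⌊n/2⌋+⌊n/2⌋≤n n =
  subst (⌊ n /2⌋ ℕ.+ ⌊ n /2⌋ ℕ.≤_) (ℕP.⌊n/2⌋+⌈n/2⌉≡n n) (ℕP.+-monoʳ-≤ ⌊ n /2⌋ (ℕP.⌊n/2⌋≤⌈n/2⌉ n))

n≤1+⌊n/2⌋+⌊n/2⌋ : ∀ n → n ℕ.≤ suc (⌊ n /2⌋ ℕ.+ ⌊ n /2⌋)
n≤1+⌊n/2⌋+⌊n/2⌋ n = subst₂ ℕ._≤_ (ℕP.⌊n/2⌋+⌈n/2⌉≡n n) (ℕP.+-suc ⌊ n /2⌋ ⌊ n /2⌋)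
                               (ℕP.+-monoʳ-≤ ⌊ n /2⌋ (ℕP.⌊n/2⌋-mono (ℕP.n≤1+n (suc n))))

symUnimodal⇒unimodal : ∀ {d p} → SymUnimodal d p → NonNegCoeffs p × Unimodal p
symUnimodal⇒unimodal {d} {p} su = nonneg su , ⌊ d /2⌋ , increasing , decreasing
  where
  h : ℕ
  h = ⌊ d /2⌋
  increasing : ∀ i → i ℕ.< h → p i ≤ p (suc i)
  increasing i i<h = ascending su i (ℕP.≤-trans (ℕP.+-mono-≤ i<h (ℕP.<⇒≤ i<h)) (⌊n/2⌋+⌊n/2⌋≤n d))
  decreasing : ∀ i → h ℕ.≤ i → p (suc i) ≤ p i
  decreasing i h≤i with suc i ℕ.≤? d
  ... | no 1+i≰d = subst (_≤ p i) (sym (vanish su (suc i) (ℕP.≰⇒> 1+i≰d))) (nonneg su i)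
  ... | yes 1+i≤d with ℕP.m≤n⇒∃[o]m+o≡n 1+i≤d
  ...   | e , refl = subst₂ _≤_ (symmetric su e (suc i) (ℕP.+-comm e (suc i)))
                                 (symmetric su (suc e) i (trans (ℕP.+-comm (suc e) i) (ℕP.+-suc i e)))
                                 (ascending-pair su (ℕP.n≤1+n e) 2e+1≤d)
    where
    e≤i : e ℕ.≤ i
    e≤i = ℕP.+-cancelˡ-≤ (suc i) e i
            (ℕP.≤-trans (n≤1+⌊n/2⌋+⌊n/2⌋ (suc i ℕ.+ e)) (s≤s (ℕP.+-mono-≤ h≤i h≤i)))
    2e+1≤d : e ℕ.+ suc e ℕ.≤ suc i ℕ.+ e
    2e+1≤d = subst (ℕ._≤ suc i ℕ.+ e) (sym (ℕP.+-suc e e)) (s≤s (ℕP.+-monoˡ-≤ e e≤i))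

⌊⌋-true : ∀ {A : Set} (a? : Dec A) → A → ⌊ a? ⌋ ≡ true
⌊⌋-true a? a = trans (isYes≗does a?) (dec-true a? a)

⌊⌋-sound : ∀ {A : Set} (a? : Dec A) → ⌊ a? ⌋ ≡ true → A
⌊⌋-sound a? ⌊a?⌋≡true = toWitness (subst T (sym ⌊a?⌋≡true) tt)

not⌊⌋-sound : ∀ {A : Set} (a? : Dec A) → not ⌊ a? ⌋ ≡ true → ¬ A
not⌊⌋-sound a? not⌊a?⌋≡true a = contradiction (trans (cong not (sym (⌊⌋-true a? a))) not⌊a?⌋≡true) λ ()

∧-≡-true : ∀ a {b} → a ∧ b ≡ true → a ≡ true × b ≡ true
∧-≡-true true {true} _ = refl , refl

module Downsets {n : ℕ} {_≼_ : Rel (Fin n) 0ℓ} (isPartialOrder : IsPartialOrder _≡_ _≼_) (_≼?_ : Decidable _≼_) where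

  open IsPartialOrder isPartialOrder using () renaming (refl to ≼-refl; trans to ≼-trans; antisym to ≼-antisym)

  infix 4 _≺_
  _≺_ : Rel (Fin n) 0ℓ
  x ≺ y = x ≼ y × x ≢ y

  ↓_ : Fin n → Subset n
  ↓ t = tabulate (λ z → ⌊ z ≼? t ⌋)

  ∈↓⁺ : ∀ {z t} → z ≼ t → z ∈ ↓ t
  ∈↓⁺ {z} {t} z≼t = lookup⇒[]= z (↓ t) (trans (lookup∘tabulate _ z) (⌊⌋-true (z ≼? t) z≼t))

  ∈↓⁻ : ∀ {z t} → z ∈ ↓ t → z ≼ t
  ∈↓⁻ {z} {t} z∈↓t = ⌊⌋-sound (z ≼? t) (trans (sym (lookup∘tabulate _ z)) ([]=⇒lookup z∈↓t))

  #↓ : Fin n → ℕ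
  #↓ t = ∣ ↓ t ∣

  #↓-positive : ∀ t → 0 ℕ.< #↓ t
  #↓-positive t = ℕP.≤-<-trans z≤n (x∈p⇒∣p-x∣<∣p∣ (∈↓⁺ ≼-refl))

  #↓≤n : ∀ t → #↓ t ℕ.≤ n
  #↓≤n t = ∣p∣≤n (↓ t)

  #↓-mono-≺ : ∀ {w t} → w ≺ t → #↓ w ℕ.< #↓ t
  #↓-mono-≺ {w} {t} (w≼t , w≢t) =
    p⊂q⇒∣p∣<∣q∣ (↓w⊆↓t , t , ∈↓⁺ ≼-refl , λ t∈↓w → w≢t (≼-antisym w≼t (∈↓⁻ t∈↓w)))
    where
    ↓w⊆↓t : ↓ w ⊆ ↓ t
    ↓w⊆↓t z∈↓w = ∈↓⁺ (≼-trans (∈↓⁻ z∈↓w) w≼t)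

  -- F k is the k-th fuelled iterate of Φ, which at t consults its argument only strictly below t;
  -- so F k t settles as soon as k ≥ #↓ t, and fuel n always suffices.
  module LocalRecursion (S : Setoid 0ℓ 0ℓ) (Φ : (Fin n → Setoid.Carrier S) → Fin n → Setoid.Carrier S)
    (Φ-local : ∀ {f g} t → (∀ w → w ≺ t → Setoid._≈_ S (f w) (g w)) → Setoid._≈_ S (Φ f t) (Φ g t))
    (F : ℕ → Fin n → Setoid.Carrier S) (F-suc : ∀ k t → Setoid._≈_ S (F (suc k) t) (Φ (F k) t)) where

    open Setoid S using (_≈_)
    open import Relation.Binary.Reasoning.Setoid S

    private
      below : ∀ {w t k} → w ≺ t → #↓ t ℕ.≤ suc k → #↓ w ℕ.≤ k
      below w≺t h = ℕP.≤-pred (ℕP.≤-trans (#↓-mono-≺ w≺t) h)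

      no-fuel : ∀ {t} → ¬ (#↓ t ℕ.≤ 0)
      no-fuel {t} h = ℕP.n≮0 (ℕP.<-≤-trans (#↓-positive t) h)

    iterate-settled : ∀ {k k′ t} → #↓ t ℕ.≤ k → #↓ t ℕ.≤ k′ → F k t ≈ F k′ t
    iterate-settled {zero}          h _  = contradiction h no-fuel
    iterate-settled {suc k} {zero}  _ h′ = contradiction h′ no-fuel
    iterate-settled {suc k} {suc k′} {t} h h′ = begin
      F (suc k) t   ≈⟨ F-suc k t ⟩
      Φ (F k) t     ≈⟨ Φ-local t (λ w w≺t → iterate-settled (below w≺t h) (below w≺t h′)) ⟩
      Φ (F k′) t    ≈⟨ F-suc k′ t ⟨
      F (suc k′) t  ∎

    iterate-fixedPoint : ∀ t → F n t ≈ Φ (F n) t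
    iterate-fixedPoint t = begin
      F n t        ≈⟨ iterate-settled (#↓≤n t) (ℕP.m≤n⇒m≤1+n (#↓≤n t)) ⟩
      F (suc n) t  ≈⟨ F-suc n t ⟩
      Φ (F n) t    ∎

    iterate-unique : ∀ {X} → (∀ t → X t ≈ Φ X t) → ∀ {k t} → #↓ t ℕ.≤ k → F k t ≈ X t
    iterate-unique         X-fixed {zero}      h = contradiction h no-fuel
    iterate-unique {X = X} X-fixed {suc k} {t} h = begin
      F (suc k) t  ≈⟨ F-suc k t ⟩
      Φ (F k) t    ≈⟨ Φ-local t (λ w w≺t → iterate-unique X-fixed (below w≺t h)) ⟩
      Φ X t        ≈⟨ X-fixed t ⟨
      X t          ∎

module Chow (P : GradedBoundedPoset) where

  open GradedBoundedPoset P
  open IsDecPartialOrder isDecPartialOrder using (isPartialOrder)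
    renaming (refl to ≼-refl; trans to ≼-trans; antisym to ≼-antisym)
  open Downsets isPartialOrder _≼?_
  module Up = Downsets (Flip.isPartialOrder isPartialOrder) (flip _≼?_)

  _≺?_ : ∀ x y → Dec (x ≺ y)
  x ≺? y = (x ≼? y) ×-dec ¬? (x ≟ y)

  data Comparison : Fin n → Fin n → Set where
    same      : ∀ {t} → Comparison t t
    below     : ∀ {s t} → s ≺ t → Comparison s t
    unrelated : ∀ {s t} → ¬ s ≼ t → Comparison s t

  compare : ∀ s t → Comparison s t
  compare s t with s ≟ t | s ≼? t
  ... | yes refl | _       = same
  ... | no s≢t   | yes s≼t = below (s≼t , s≢t)
  ... | no _     | no s⋠t  = unrelated s⋠t

  -- the case distinction with which every recursion of the incidence algebra in Defs starts
  byCases : ∀ {A : Set} → Fin n → Fin n → A → A → A → A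
  byCases s t a b c = if ⌊ s ≟ t ⌋ then a else if ⌊ s ≼? t ⌋ then b else c

  module _ {A : Set} {a b c : A} where

    byCases-same : ∀ {t} → byCases t t a b c ≡ a
    byCases-same {t} with t ≟ t
    ... | yes _   = refl
    ... | no t≢t  = contradiction refl t≢t

    byCases-below : ∀ {s t} → s ≺ t → byCases s t a b c ≡ b
    byCases-below {s} {t} (s≼t , s≢t) with s ≟ t | s ≼? t
    ... | yes s≡t | _       = contradiction s≡t s≢t
    ... | no _    | yes _   = refl
    ... | no _    | no s⋠t  = contradiction s≼t s⋠t

    byCases-unrelated : ∀ {s t} → ¬ s ≼ t → byCases s t a b c ≡ c
    byCases-unrelated {s} {t} s⋠t with s ≟ t | s ≼? t
    ... | yes refl | _       = contradiction ≼-refl s⋠t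
    ... | no _     | yes s≼t = contradiction s≼t s⋠t
    ... | no _     | no _    = refl

  byCases-cong-below : ∀ s t (p : Poly) {q q′ : Poly} r k → q k ≡ q′ k → byCases s t p q r k ≡ byCases s t p q′ r k
  byCases-cong-below s t p {q} {q′} r k q≡q′ = begin
    byCases s t p q r k              ≡⟨ apply q ⟩
    byCases s t (p k) (q k) (r k)    ≡⟨ cong (λ x → byCases s t (p k) x (r k)) q≡q′ ⟩
    byCases s t (p k) (q′ k) (r k)   ≡⟨ apply q′ ⟨
    byCases s t p q′ r k             ∎
    where
    open ≡-Reasoning
    apply : ∀ q → byCases s t p q r k ≡ byCases s t (p k) (q k) (r k)
    apply q = trans (if-float (_$ k) ⌊ s ≟ t ⌋) (cong (if ⌊ s ≟ t ⌋ then p k else_) (if-float (_$ k) ⌊ s ≼? t ⌋))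

  ρ-increasing : ∀ {s t} → s ≺ t → ρ s ℕ.< ρ t
  ρ-increasing {s} {t} = go (#↓ t ℕ.+ Up.#↓ s) ℕP.≤-refl
    where
    -- induction on #↓ t + #↑ s: either t covers s, or some s ≺ z ≺ t splits [s, t] into smaller intervals
    go : ∀ k {s t} → #↓ t ℕ.+ Up.#↓ s ℕ.≤ k → s ≺ t → ρ s ℕ.< ρ t
    go zero    {s} {t} h _ = contradiction (ℕP.≤-trans (ℕP.m≤m+n (#↓ t) _) h) (ℕP.<⇒≱ (#↓-positive t))
    go (suc k) {s} {t} h (s≼t , s≢t) with any? (λ z → (s ≺? z) ×-dec (z ≺? t))
    ... | yes (z , s≺z , z≺t) =
      ℕP.<-trans (go k (ℕP.≤-pred (ℕP.≤-trans (ℕP.+-monoˡ-< (Up.#↓ s) (#↓-mono-≺ z≺t)) h)) s≺z)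
                 (go k (ℕP.≤-pred (ℕP.≤-trans (ℕP.+-monoʳ-< (#↓ t) (Up.#↓-mono-≺ (proj₁ s≺z , z≢s))) h)) z≺t)
      where
      z≢s : z ≢ s
      z≢s = proj₂ s≺z ∘ sym
    ... | no nothing-between = ℕP.≤-reflexive (sym (ρ-cover s t (s≼t , s≢t , only-ends)))
      where
      only-ends : ∀ z → s ≼ z → z ≼ t → z ≡ s ⊎ z ≡ t
      only-ends z s≼z z≼t with z ≟ s | z ≟ t
      ... | yes z≡s | _       = inj₁ z≡s
      ... | no _    | yes z≡t = inj₂ z≡t
      ... | no z≢s  | no z≢t  = ⊥-elim (nothing-between (z , (s≼z , z≢s ∘ sym) , (z≼t , z≢t)))

  ρ-mono : ∀ {s t} → s ≼ t → ρ s ℕ.≤ ρ t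
  ρ-mono {s} {t} s≼t with compare s t
  ... | same        = ℕP.≤-refl
  ... | below s≺t   = ℕP.<⇒≤ (ρ-increasing s≺t)
  ... | unrelated s⋠t = contradiction s≼t s⋠t

  ρ-gap : ∀ {w t} → w ≺ t → ρ t ∸ ρ w ≡ suc (ρ t ∸ suc (ρ w))
  ρ-gap w≺t = ℕP.+-∸-assoc 1 (ρ-increasing w≺t)

  ρ-split : ∀ {s w t} → s ≼ w → w ≺ t → (ρ w ∸ ρ s) ℕ.+ suc (ρ t ∸ suc (ρ w)) ≡ ρ t ∸ ρ s
  ρ-split {s} {w} {t} s≼w w≺t = begin
    (ρ w ∸ ρ s) ℕ.+ suc (ρ t ∸ suc (ρ w))   ≡⟨ cong ((ρ w ∸ ρ s) ℕ.+_) (ρ-gap w≺t) ⟨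
    (ρ w ∸ ρ s) ℕ.+ (ρ t ∸ ρ w)             ≡⟨ ℕP.+-comm (ρ w ∸ ρ s) _ ⟩
    (ρ t ∸ ρ w) ℕ.+ (ρ w ∸ ρ s)             ≡⟨ ℕP.+-∸-assoc (ρ t ∸ ρ w) (ρ-mono s≼w) ⟨
    (ρ t ∸ ρ w) ℕ.+ ρ w ∸ ρ s               ≡⟨ cong (_∸ ρ s) (ℕP.m∸n+n≡m (ρ-mono (proj₁ w≺t))) ⟩
    ρ t ∸ ρ s                               ∎
    where open ≡-Reasoning

  ∑⋯ : Fin n → Fin n → (Fin n → ℤ) → ℤ
  ∑⋯ s t = ∑⟨ (λ w → inInterval P s w t) ⟩
  syntax ∑⋯ s t (λ w → e) = ∑[ w ∈ s ⋯ t ] e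

  ∑⋯< : Fin n → Fin n → (Fin n → ℤ) → ℤ
  ∑⋯< s t = ∑⟨ (λ w → inIntervalCO P s w t) ⟩
  syntax ∑⋯< s t (λ w → e) = ∑[ w ∈ s ⋯< t ] e

  ∈⋯⁺ : ∀ {s w t} → s ≼ w → w ≼ t → inInterval P s w t ≡ true
  ∈⋯⁺ {s} {w} {t} s≼w w≼t = cong₂ _∧_ (⌊⌋-true (s ≼? w) s≼w) (⌊⌋-true (w ≼? t) w≼t)

  ∈⋯⁻ : ∀ {s w t} → inInterval P s w t ≡ true → s ≼ w × w ≼ t
  ∈⋯⁻ {s} {w} {t} w∈ with ∧-≡-true ⌊ s ≼? w ⌋ w∈
  ... | s≼w , w≼t = ⌊⌋-sound (s ≼? w) s≼w , ⌊⌋-sound (w ≼? t) w≼t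

  ∈⋯≢⁻ : ∀ {s w t v} → (inInterval P s w t ∧ not ⌊ w ≟ v ⌋) ≡ true → s ≼ w × w ≼ t × w ≢ v
  ∈⋯≢⁻ {s} {w} {t} {v} h with ∧-≡-true (inInterval P s w t) h
  ... | w∈ , w≢v = proj₁ (∈⋯⁻ w∈) , proj₂ (∈⋯⁻ w∈) , not⌊⌋-sound (w ≟ v) w≢v

  ∈⋯<⁻ : ∀ {s w t} → inIntervalCO P s w t ≡ true → s ≼ w × w ≺ t
  ∈⋯<⁻ w∈ with ∈⋯≢⁻ w∈
  ... | s≼w , w≼t , w≢t = s≼w , w≼t , w≢t

  ∑⋯-cong : ∀ {s t f g} → (∀ w → s ≼ w → w ≼ t → f w ≡ g w) → ∑⋯ s t f ≡ ∑⋯ s t g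
  ∑⋯-cong {s} {t} f≡g =
    ∑⟨⟩-cong {b = λ w → inInterval P s w t} (λ w w∈ → f≡g w (proj₁ (∈⋯⁻ w∈)) (proj₂ (∈⋯⁻ w∈)))

  ∑⋯<-cong : ∀ {s t f g} → (∀ w → s ≼ w → w ≺ t → f w ≡ g w) → ∑⋯< s t f ≡ ∑⋯< s t g
  ∑⋯<-cong {s} {t} f≡g =
    ∑⟨⟩-cong {b = λ w → inIntervalCO P s w t} (λ w w∈ → f≡g w (proj₁ (∈⋯<⁻ w∈)) (proj₂ (∈⋯<⁻ w∈)))

  ∑⋯-empty : ∀ {s t} f → ¬ s ≼ t → ∑⋯ s t f ≡ 0ℤ
  ∑⋯-empty {s} {t} f s⋠t =
    ∑⟨⟩-zero {b = λ w → inInterval P s w t}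
      (λ w w∈ → contradiction (≼-trans (proj₁ (∈⋯⁻ w∈)) (proj₂ (∈⋯⁻ w∈))) s⋠t)

  ∑⋯-top : ∀ {s t} f → s ≼ t → ∑⋯ s t f ≡ f t + ∑⋯< s t f
  ∑⋯-top {s} {t} f s≼t = ∑⟨⟩-split {b = λ w → inInterval P s w t} f (∈⋯⁺ s≼t ≼-refl)

  ∑⋯-bottom : ∀ {s t} f → s ≼ t → ∑⋯ s t f ≡ f s + ∑⟨ (λ w → inInterval P s w t ∧ not ⌊ w ≟ s ⌋) ⟩ f
  ∑⋯-bottom {s} {t} f s≼t = ∑⟨⟩-split {b = λ w → inInterval P s w t} f (∈⋯⁺ ≼-refl s≼t)

  ∑⋯-single : ∀ {t} f → ∑⋯ t t f ≡ f t
  ∑⋯-single {t} f = begin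
    ∑⋯ t t f              ≡⟨ ∑⋯-top f ≼-refl ⟩
    f t + ∑⋯< t t f       ≡⟨ cong (f t +_) (∑⟨⟩-zero {b = λ w → inIntervalCO P t w t}
                                                      (λ _ w∈ → ⊥-elim (no-w (∈⋯<⁻ w∈)))) ⟩
    f t + 0ℤ              ≡⟨ ℤP.+-identityʳ (f t) ⟩
    f t                   ∎
    where
    open ≡-Reasoning
    no-w : ∀ {w} → ¬ (t ≼ w × w ≺ t)
    no-w (t≼w , w≼t , w≢t) = w≢t (≼-antisym w≼t t≼w)

  ∑⋯-comm : ∀ s t (f : Fin n → Fin n → ℤ) →
            ∑[ v ∈ s ⋯ t ] ∑[ w ∈ v ⋯ t ] f v w ≡ ∑[ w ∈ s ⋯ t ] ∑[ v ∈ s ⋯ w ] f v w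
  ∑⋯-comm s t f = ∑⟨⟩-comm f (λ v w → ⇔→≡ (mk⇔ forth back))
    where
    forth : ∀ {v w} → (inInterval P s v t ∧ inInterval P v w t) ≡ true →
                      (inInterval P s w t ∧ inInterval P s v w) ≡ true
    forth {v} {w} h with ∧-≡-true (inInterval P s v t) h
    ... | v∈ , w∈ with ∈⋯⁻ {s} {v} {t} v∈ | ∈⋯⁻ {v} {w} {t} w∈
    ... | s≼v , _ | v≼w , w≼t = cong₂ _∧_ (∈⋯⁺ (≼-trans s≼v v≼w) w≼t) (∈⋯⁺ s≼v v≼w)
    back : ∀ {v w} → (inInterval P s w t ∧ inInterval P s v w) ≡ true →
                     (inInterval P s v t ∧ inInterval P v w t) ≡ true
    back {v} {w} h with ∧-≡-true (inInterval P s w t) h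
    ... | w∈ , v∈ with ∈⋯⁻ {s} {w} {t} w∈ | ∈⋯⁻ {s} {v} {w} v∈
    ... | _ , w≼t | s≼v , v≼w = cong₂ _∧_ (∈⋯⁺ s≼v (≼-trans v≼w w≼t)) (∈⋯⁺ v≼w w≼t)

  δ : Fin n → Fin n → ℤ
  δ v w = if ⌊ v ≟ w ⌋ then 1ℤ else 0ℤ

  δ-same : ∀ {t} → δ t t ≡ 1ℤ
  δ-same {t} = cong (if_then 1ℤ else 0ℤ) (⌊⌋-true (t ≟ t) refl)

  δ-≢ : ∀ {v w} → v ≢ w → δ v w ≡ 0ℤ
  δ-≢ {v} {w} v≢w with v ≟ w
  ... | yes v≡w = contradiction v≡w v≢w
  ... | no _    = refl

  ∑⋯-δ-top : ∀ {s t} (g : Fin n → ℤ) → s ≼ t → ∑[ w ∈ s ⋯ t ] (g w * δ w t) ≡ g t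
  ∑⋯-δ-top {s} {t} g s≼t = begin
    ∑[ w ∈ s ⋯ t ] (g w * δ w t)                        ≡⟨ ∑⋯-top (λ w → g w * δ w t) s≼t ⟩
    g t * δ t t + ∑[ w ∈ s ⋯< t ] (g w * δ w t)         ≡⟨ cong₂ _+_ (cong (g t *_) δ-same) off-top ⟩
    g t * 1ℤ + 0ℤ                                     ≡⟨ trans (ℤP.+-identityʳ _) (ℤP.*-identityʳ (g t)) ⟩
    g t                                               ∎
    where
    open ≡-Reasoning
    off-top : ∑[ w ∈ s ⋯< t ] (g w * δ w t) ≡ 0ℤ
    off-top = ∑⟨⟩-zero {b = λ w → inIntervalCO P s w t}
      (λ w w∈ → trans (cong (g w *_) (δ-≢ (proj₂ (proj₂ (∈⋯<⁻ w∈))))) (ℤP.*-zeroʳ (g w)))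

  ∑⋯-δ-bottom : ∀ {s t} (g : Fin n → ℤ) → s ≼ t → ∑[ w ∈ s ⋯ t ] (g w * δ s w) ≡ g s
  ∑⋯-δ-bottom {s} {t} g s≼t = begin
    ∑[ w ∈ s ⋯ t ] (g w * δ s w)   ≡⟨ ∑⋯-bottom (λ w → g w * δ s w) s≼t ⟩
    g s * δ s s + off-bottom       ≡⟨ cong₂ _+_ (cong (g s *_) δ-same) off-bottom≡0 ⟩
    g s * 1ℤ + 0ℤ                  ≡⟨ trans (ℤP.+-identityʳ _) (ℤP.*-identityʳ (g s)) ⟩
    g s                            ∎
    where
    open ≡-Reasoning
    off-bottom : ℤ
    off-bottom = ∑⟨ (λ w → inInterval P s w t ∧ not ⌊ w ≟ s ⌋) ⟩ (λ w → g w * δ s w)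
    off-bottom≡0 : off-bottom ≡ 0ℤ
    off-bottom≡0 = ∑⟨⟩-zero {b = λ w → inInterval P s w t ∧ not ⌊ w ≟ s ⌋}
      (λ w w∈ → trans (cong (g w *_) (δ-≢ (proj₂ (proj₂ (∈⋯≢⁻ w∈)) ∘ sym))) (ℤP.*-zeroʳ (g w)))

  μ : Fin n → Fin n → ℤ
  μ = mobius P

  Φμ : Fin n → (Fin n → ℤ) → Fin n → ℤ
  Φμ s f t = byCases s t 1ℤ (- ∑[ w ∈ s ⋯< t ] f w) 0ℤ

  μ-fixedPoint : ∀ s t → μ s t ≡ Φμ s (μ s) t
  μ-fixedPoint s = LocalRecursion.iterate-fixedPoint (setoid ℤ) (Φμ s) local (λ k → mobiusF P k s) (λ _ _ → refl)
    where
    local : ∀ {f g} t → (∀ w → w ≺ t → f w ≡ g w) → Φμ s f t ≡ Φμ s g t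
    local t f≡g = cong (λ x → byCases s t 1ℤ (- x) 0ℤ) (∑⋯<-cong (λ w _ w≺t → f≡g w w≺t))

  μ-same : ∀ {t} → μ t t ≡ 1ℤ
  μ-same {t} = trans (μ-fixedPoint t t) (byCases-same {t = t})

  μ-below : ∀ {s t} → s ≺ t → μ s t ≡ - ∑[ w ∈ s ⋯< t ] μ s w
  μ-below {s} {t} s≺t = trans (μ-fixedPoint s t) (byCases-below s≺t)

  μ-sum-left : ∀ {s t} → s ≼ t → ∑[ w ∈ s ⋯ t ] μ s w ≡ δ s t
  μ-sum-left {s} {t} s≼t with compare s t
  ... | same          = trans (∑⋯-single (μ t)) (trans μ-same (sym δ-same))
  ... | below s≺t     = begin
    ∑[ w ∈ s ⋯ t ] μ s w                            ≡⟨ ∑⋯-top (μ s) s≼t ⟩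
    μ s t + ∑[ w ∈ s ⋯< t ] μ s w                   ≡⟨ cong (_+ ∑[ w ∈ s ⋯< t ] μ s w) (μ-below s≺t) ⟩
    - ∑[ w ∈ s ⋯< t ] μ s w + ∑[ w ∈ s ⋯< t ] μ s w ≡⟨ ℤP.+-inverseˡ (∑[ w ∈ s ⋯< t ] μ s w) ⟩
    0ℤ                                              ≡⟨ δ-≢ (proj₂ s≺t) ⟨
    δ s t                                           ∎
    where open ≡-Reasoning
  ... | unrelated s⋠t = contradiction s≼t s⋠t

  -- μ ζ μ = μ, read with the inner sums ζ μ still unevaluated
  μ-sum-sandwich : ∀ {v u} → v ≼ u → ∑[ w ∈ v ⋯ u ] (μ v w * ∑[ x ∈ w ⋯ u ] μ x u) ≡ μ v u
  μ-sum-sandwich {v} {u} v≼u = begin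
    ∑[ w ∈ v ⋯ u ] (μ v w * ∑[ x ∈ w ⋯ u ] μ x u)
      ≡⟨ ∑⋯-cong (λ w _ _ → sym (∑⟨⟩-*ˡ (μ v w) (λ x → μ x u))) ⟩
    ∑[ w ∈ v ⋯ u ] ∑[ x ∈ w ⋯ u ] (μ v w * μ x u)
      ≡⟨ ∑⋯-comm v u (λ w x → μ v w * μ x u) ⟩
    ∑[ x ∈ v ⋯ u ] ∑[ w ∈ v ⋯ x ] (μ v w * μ x u)
      ≡⟨ ∑⋯-cong (λ x v≼x _ → trans (∑⋯-cong (λ w _ _ → ℤP.*-comm (μ v w) (μ x u)))
                                    (trans (∑⟨⟩-*ˡ (μ x u) (μ v)) (cong (μ x u *_) (μ-sum-left v≼x)))) ⟩
    ∑[ x ∈ v ⋯ u ] (μ x u * δ v x)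
      ≡⟨ ∑⋯-δ-bottom (λ x → μ x u) v≼u ⟩
    μ v u
      ∎
    where open ≡-Reasoning

  μ-sum-right : ∀ {v u} → v ≼ u → ∑[ w ∈ v ⋯ u ] μ w u ≡ δ v u
  μ-sum-right {v} = go (Up.#↓ v) ℕP.≤-refl
    where
    -- induction on #↑ v: the sums of μ v w * L w and of μ v w * δ w u over [v, u] both equal μ v u,
    -- and by induction their terms agree except at w = v, where they are L v and δ v u
    go : ∀ k {v u} → Up.#↓ v ℕ.≤ k → v ≼ u → ∑[ w ∈ v ⋯ u ] μ w u ≡ δ v u
    go zero    {v} h _ = contradiction h (ℕP.<⇒≱ (Up.#↓-positive v))
    go (suc k) {v} {u} h v≼u = ∙-cancelʳ rest _ _ (begin
      L v + rest                        ≡⟨ cong (L v +_) L≡δ ⟨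
      L v + restL                       ≡⟨ cong (_+ restL) (μ-same-* (L v)) ⟨
      μ v v * L v + restL               ≡⟨ ∑⋯-bottom (λ w → μ v w * L w) v≼u ⟨
      ∑[ w ∈ v ⋯ u ] (μ v w * L w)      ≡⟨ μ-sum-sandwich v≼u ⟩
      μ v u                             ≡⟨ ∑⋯-δ-top (μ v) v≼u ⟨
      ∑[ w ∈ v ⋯ u ] (μ v w * δ w u)    ≡⟨ ∑⋯-bottom (λ w → μ v w * δ w u) v≼u ⟩
      μ v v * δ v u + rest              ≡⟨ cong (_+ rest) (μ-same-* (δ v u)) ⟩
      δ v u + rest                      ∎)
      where
      open ≡-Reasoning
      L : Fin n → ℤ
      L w = ∑[ x ∈ w ⋯ u ] μ x u
      μ-same-* : ∀ x → μ v v * x ≡ x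
      μ-same-* x = trans (cong (_* x) μ-same) (ℤP.*-identityˡ x)
      rest restL : ℤ
      rest  = ∑⟨ (λ w → inInterval P v w u ∧ not ⌊ w ≟ v ⌋) ⟩ (λ w → μ v w * δ w u)
      restL = ∑⟨ (λ w → inInterval P v w u ∧ not ⌊ w ≟ v ⌋) ⟩ (λ w → μ v w * L w)
      L≡δ : restL ≡ rest
      L≡δ = ∑⟨⟩-cong (λ w w∈ → let (v≼w , w≼u , w≢v) = ∈⋯≢⁻ w∈ in
              cong (μ v w *_) (go k (ℕP.≤-pred (ℕP.≤-trans (Up.#↓-mono-≺ (v≼w , w≢v)) h)) w≼u))

  chi-as-sum : ∀ s t k → chi P s t k ≡ ∑[ w ∈ s ⋯ t ] (μ s w * xPow (ρ t ∸ ρ w) k)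
  chi-as-sum s t k = sumFin-cong (λ w → masked (inInterval P s w t) ⌊ ρ t ∸ ρ w ℕ.≟ k ⌋)
    where
    masked : ∀ a c {x} → (if a ∧ c then x else 0ℤ) ≡ (if a then x * (if c then 1ℤ else 0ℤ) else 0ℤ)
    masked false c         = refl
    masked true  true  {x} = sym (ℤP.*-identityʳ x)
    masked true  false {x} = sym (ℤP.*-zeroʳ x)

  χ̄-below : ∀ {w t} → w ≺ t → ∀ j → chiBar P w t j ≡ ∑[ u ∈ w ⋯ t ] (μ w u * qInt (ρ t ∸ ρ u) j)
  χ̄-below {w} {t} w≺t j = begin
    chiBar P w t j
      ≡⟨ cong (_$ j) (byCases-below w≺t) ⟩
    - sumUpTo j (chi P w t)
      ≡⟨ cong -_ (sumUpTo-cong j (λ i _ → chi-as-sum w t i)) ⟩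
    - sumUpTo j (λ i → ∑[ u ∈ w ⋯ t ] (μ w u * xPow (ρ t ∸ ρ u) i))
      ≡⟨ cong -_ (sumUpTo-∑⟨⟩ j {b = λ u → inInterval P w u t} (λ i u → μ w u * xPow (ρ t ∸ ρ u) i)) ⟩
    - ∑[ u ∈ w ⋯ t ] sumUpTo j (λ i → μ w u * xPow (ρ t ∸ ρ u) i)
      ≡⟨ cong -_ (∑⋯-cong (λ u _ _ → trans (sumUpTo-*ˡ j (μ w u) _)
                                           (cong (μ w u *_) (xPow-prefixSum (ρ t ∸ ρ u) j)))) ⟩
    - ∑[ u ∈ w ⋯ t ] (μ w u * (1ℤ - qInt (ρ t ∸ ρ u) j))
      ≡⟨ cong -_ (∑⋯-cong (λ u _ _ → distrib (μ w u) (qInt (ρ t ∸ ρ u) j))) ⟩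
    - ∑[ u ∈ w ⋯ t ] (μ w u + - (μ w u * qInt (ρ t ∸ ρ u) j))
      ≡⟨ cong -_ (∑⟨⟩-+ (μ w) (λ u → - (μ w u * qInt (ρ t ∸ ρ u) j))) ⟩
    - (∑[ u ∈ w ⋯ t ] μ w u + ∑[ u ∈ w ⋯ t ] (- (μ w u * qInt (ρ t ∸ ρ u) j)))
      ≡⟨ cong -_ (cong₂ _+_ (trans (μ-sum-left (proj₁ w≺t)) (δ-≢ (proj₂ w≺t)))
                            (∑⟨⟩-neg (λ u → μ w u * qInt (ρ t ∸ ρ u) j))) ⟩
    - (0ℤ + - ∑[ u ∈ w ⋯ t ] (μ w u * qInt (ρ t ∸ ρ u) j))
      ≡⟨ trans (cong -_ (ℤP.+-identityˡ _)) (ℤP.neg-involutive _) ⟩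
    ∑[ u ∈ w ⋯ t ] (μ w u * qInt (ρ t ∸ ρ u) j)
      ∎
    where
    open ≡-Reasoning
    distrib : ∀ a q → a * (1ℤ - q) ≡ a + - (a * q)
    distrib = solve-∀

  lastStep : Fin n → (Fin n → Poly) → Fin n → Poly
  lastStep s f t k = ∑[ w ∈ s ⋯< t ] shift (f w *P qInt (ρ t ∸ suc (ρ w))) k

  Φchain : Fin n → (Fin n → Poly) → Fin n → Poly
  Φchain s f t = byCases s t (constP 1ℤ) (lastStep s f t) 0P

  chainPolyF : Fin n → ℕ → Fin n → Poly
  chainPolyF s zero    t = 0P
  chainPolyF s (suc k) t = Φchain s (chainPolyF s k) t

  -- chainPoly s t is the sum, over chains s = w₀ < w₁ < ⋯ < wₖ = t, of ∏ᵢ x [ρ wᵢ₊₁ - ρ wᵢ - 1]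
  chainPoly : Fin n → Fin n → Poly
  chainPoly s = chainPolyF s n

  chainPoly-fixedPoint : ∀ s t → chainPoly s t ≗ Φchain s (chainPoly s) t
  chainPoly-fixedPoint s =
    LocalRecursion.iterate-fixedPoint (ℕ →-setoid ℤ) (Φchain s) local (chainPolyF s) (λ _ _ _ → refl)
    where
    local : ∀ {f g} t → (∀ w → w ≺ t → f w ≗ g w) → Φchain s f t ≗ Φchain s g t
    local t f≗g k = byCases-cong-below s t (constP 1ℤ) 0P k
      (∑⋯<-cong (λ w _ w≺t → shift-cong (*P-congˡ (qInt (ρ t ∸ suc (ρ w))) (f≗g w w≺t)) k))

  chainPoly-same : ∀ {t} → chainPoly t t ≗ constP 1ℤ
  chainPoly-same {t} k = trans (chainPoly-fixedPoint t t k) (cong (_$ k) (byCases-same {t = t}))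

  chainPoly-below : ∀ {s t} → s ≺ t → ∀ k →
                    chainPoly s t k ≡ ∑[ w ∈ s ⋯< t ] shift (chainPoly s w *P qInt (ρ t ∸ suc (ρ w))) k
  chainPoly-below {s} {t} s≺t k = trans (chainPoly-fixedPoint s t k) (cong (_$ k) (byCases-below s≺t))

  chainPolyF-symUnimodal : ∀ s k t → SymUnimodal (ρ t ∸ ρ s) (chainPolyF s k t)
  chainPolyF-symUnimodal s zero    t = symUnimodal-0P
  chainPolyF-symUnimodal s (suc k) t with compare s t
  ... | same =
    subst (λ d → SymUnimodal d (chainPolyF s (suc k) s)) (sym (ℕP.n∸n≡0 (ρ s)))
          (symUnimodal-≗ (λ j → sym (cong (_$ j) (byCases-same {t = s}))) symUnimodal-1)
  ... | below s≺t =
    symUnimodal-≗ (λ j → sym (cong (_$ j) (byCases-below s≺t)))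
      (symUnimodal-∑⟨⟩ {b = λ w → inIntervalCO P s w t} {p = step} term)
    where
    step : Fin n → Poly
    step w = shift (chainPolyF s k w *P qInt (ρ t ∸ suc (ρ w)))
    term : ∀ w → inIntervalCO P s w t ≡ true → SymUnimodal (ρ t ∸ ρ s) (step w)
    term w w∈ with ∈⋯<⁻ w∈
    ... | s≼w , w≺t = subst (λ d → SymUnimodal d (step w)) (ρ-split s≼w w≺t)
                            (symUnimodal-x*qInt (chainPolyF-symUnimodal s k w) (ρ t ∸ suc (ρ w)))
  ... | unrelated s⋠t = symUnimodal-≗ (λ j → sym (cong (_$ j) (byCases-unrelated s⋠t))) symUnimodal-0P

  chainPolySum : Fin n → Fin n → Poly
  chainPolySum s t k = ∑[ v ∈ s ⋯ t ] chainPoly s v k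

  chainPolySum-same : ∀ {t} → chainPolySum t t ≗ constP 1ℤ
  chainPolySum-same {t} k = trans (∑⋯-single (λ v → chainPoly t v k)) (chainPoly-same k)

  chainPolySum-qInt : ∀ {s t} → s ≺ t → ∀ k →
                      chainPolySum s t k ≡ ∑[ u ∈ s ⋯ t ] (chainPoly s u *P qInt (ρ t ∸ ρ u)) k
  chainPolySum-qInt {s} {t} s≺t@(s≼t , _) k = begin
    ∑[ u ∈ s ⋯ t ] G u k
      ≡⟨ ∑⋯-top (λ u → G u k) s≼t ⟩
    G t k + ∑[ u ∈ s ⋯< t ] G u k
      ≡⟨ cong (_+ ∑[ u ∈ s ⋯< t ] G u k) (chainPoly-below s≺t k) ⟩
    ∑[ u ∈ s ⋯< t ] shift (G u *P qInt (ρ t ∸ suc (ρ u))) k + ∑[ u ∈ s ⋯< t ] G u k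
      ≡⟨ ℤP.+-comm (∑[ u ∈ s ⋯< t ] shift (G u *P qInt (ρ t ∸ suc (ρ u))) k) _ ⟩
    ∑[ u ∈ s ⋯< t ] G u k + ∑[ u ∈ s ⋯< t ] shift (G u *P qInt (ρ t ∸ suc (ρ u))) k
      ≡⟨ ∑⟨⟩-+ (λ u → G u k) (λ u → shift (G u *P qInt (ρ t ∸ suc (ρ u))) k) ⟨
    ∑[ u ∈ s ⋯< t ] (G u k + shift (G u *P qInt (ρ t ∸ suc (ρ u))) k)
      ≡⟨ ∑⋯<-cong (λ u _ u≺t → sym (trans (cong (λ m → (G u *P qInt m) k) (ρ-gap u≺t)) (*P-qInt-suc (G u) _ k))) ⟩
    ∑[ u ∈ s ⋯< t ] (G u *P qInt (ρ t ∸ ρ u)) k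
      ≡⟨ ℤP.+-identityˡ _ ⟨
    0ℤ + ∑[ u ∈ s ⋯< t ] (G u *P qInt (ρ t ∸ ρ u)) k
      ≡⟨ cong (_+ ∑[ u ∈ s ⋯< t ] (G u *P qInt (ρ t ∸ ρ u)) k) (*P-qInt-n∸n (G t) (ρ t) k) ⟨
    (G t *P qInt (ρ t ∸ ρ t)) k + ∑[ u ∈ s ⋯< t ] (G u *P qInt (ρ t ∸ ρ u)) k
      ≡⟨ ∑⋯-top (λ u → (G u *P qInt (ρ t ∸ ρ u)) k) s≼t ⟨
    ∑[ u ∈ s ⋯ t ] (G u *P qInt (ρ t ∸ ρ u)) k
      ∎
    where
    open ≡-Reasoning
    G : Fin n → Poly
    G = chainPoly s

  -- chainPolySum = chainPoly ζ, so multiplying by μ on the right recovers chainPoly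
  chainPolySum-μ : ∀ {s u} → s ≼ u → ∀ i → ∑[ w ∈ s ⋯ u ] (μ w u * chainPolySum s w i) ≡ chainPoly s u i
  chainPolySum-μ {s} {u} s≼u i = begin
    ∑[ w ∈ s ⋯ u ] (μ w u * ∑[ v ∈ s ⋯ w ] G v i)
      ≡⟨ ∑⋯-cong (λ w _ _ → sym (∑⟨⟩-*ˡ (μ w u) (λ v → G v i))) ⟩
    ∑[ w ∈ s ⋯ u ] ∑[ v ∈ s ⋯ w ] (μ w u * G v i)
      ≡⟨ ∑⋯-comm s u (λ v w → μ w u * G v i) ⟨
    ∑[ v ∈ s ⋯ u ] ∑[ w ∈ v ⋯ u ] (μ w u * G v i)
      ≡⟨ ∑⋯-cong (λ v _ v≼u → trans (∑⋯-cong (λ w _ _ → ℤP.*-comm (μ w u) (G v i)))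
                                    (trans (∑⟨⟩-*ˡ (G v i) (λ w → μ w u)) (cong (G v i *_) (μ-sum-right v≼u)))) ⟩
    ∑[ v ∈ s ⋯ u ] (G v i * δ v u)
      ≡⟨ ∑⋯-δ-top (λ v → G v i) s≼u ⟩
    G u i
      ∎
    where
    open ≡-Reasoning
    G : Fin n → Poly
    G = chainPoly s

  chainPolySum-χ̄ : ∀ {s t} → s ≺ t → ∀ k →
                   ∑[ w ∈ s ⋯< t ] (chainPolySum s w *P chiBar P w t) k ≡ chainPolySum s t k
  chainPolySum-χ̄ {s} {t} s≺t@(s≼t , _) k = begin
    ∑[ w ∈ s ⋯< t ] (F w *P chiBar P w t) k
      ≡⟨ ∑⋯<-cong (λ w _ w≺t → trans (*P-congʳ (F w) (χ̄-below w≺t) k) (*P-∑⟨⟩ (F w) (μ w) q k)) ⟩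
    ∑[ w ∈ s ⋯< t ] term w
      ≡⟨ ℤP.+-identityˡ _ ⟨
    0ℤ + ∑[ w ∈ s ⋯< t ] term w
      ≡⟨ cong (_+ ∑[ w ∈ s ⋯< t ] term w) term-top ⟨
    term t + ∑[ w ∈ s ⋯< t ] term w
      ≡⟨ ∑⋯-top term s≼t ⟨
    ∑[ w ∈ s ⋯ t ] ∑[ u ∈ w ⋯ t ] (μ w u * (F w *P q u) k)
      ≡⟨ ∑⋯-comm s t (λ w u → μ w u * (F w *P q u) k) ⟩
    ∑[ u ∈ s ⋯ t ] ∑[ w ∈ s ⋯ u ] (μ w u * (F w *P q u) k)
      ≡⟨ ∑⋯-cong (λ u _ _ → ∑⟨⟩-*P (λ w → μ w u) F (q u) k) ⟨
    ∑[ u ∈ s ⋯ t ] ((λ i → ∑[ w ∈ s ⋯ u ] (μ w u * F w i)) *P q u) k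
      ≡⟨ ∑⋯-cong (λ u s≼u _ → *P-congˡ (q u) (chainPolySum-μ s≼u) k) ⟩
    ∑[ u ∈ s ⋯ t ] (chainPoly s u *P q u) k
      ≡⟨ chainPolySum-qInt s≺t k ⟨
    F t k
      ∎
    where
    open ≡-Reasoning
    F : Fin n → Poly
    F = chainPolySum s
    q : Fin n → Poly
    q u = qInt (ρ t ∸ ρ u)
    term : Fin n → ℤ
    term w = ∑[ u ∈ w ⋯ t ] (μ w u * (F w *P q u) k)
    term-top : term t ≡ 0ℤ
    term-top = trans (∑⋯-single (λ u → μ t u * (F t *P q u) k))
                     (trans (cong (μ t t *_) (*P-qInt-n∸n (F t) (ρ t) k)) (ℤP.*-zeroʳ (μ t t)))

  chainPolySum-symUnimodal : ∀ {s t} → s ≼ t → ∃[ d ] SymUnimodal d (chainPolySum s t)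
  chainPolySum-symUnimodal {s} {t} s≼t with compare s t
  ... | same          = 0 , symUnimodal-≗ (λ k → sym (chainPolySum-same k)) symUnimodal-1
  ... | unrelated s⋠t = contradiction s≼t s⋠t
  ... | below s≺t     = ℕ.pred (ρ t ∸ ρ s) ,
    symUnimodal-≗ (λ k → sym (chainPolySum-qInt s≺t k))
      (symUnimodal-∑⟨⟩ {b = λ u → inInterval P s u t} {p = λ u → chainPoly s u *P qInt (ρ t ∸ ρ u)} term)
    where
    term : ∀ u → inInterval P s u t ≡ true → SymUnimodal (ℕ.pred (ρ t ∸ ρ s)) (chainPoly s u *P qInt (ρ t ∸ ρ u))
    term u u∈ with compare u t
    ... | same          = symUnimodal-≗ (λ k → sym (*P-qInt-n∸n (chainPoly s t) (ρ t) k)) symUnimodal-0P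
    ... | unrelated u⋠t = contradiction (proj₂ (∈⋯⁻ u∈)) u⋠t
    ... | below u≺t     =
      subst₂ SymUnimodal (cong ℕ.pred (trans (sym (ℕP.+-suc (ρ u ∸ ρ s) _)) (ρ-split s≼u u≺t)))
                         (cong (λ m → chainPoly s u *P qInt m) (sym (ρ-gap u≺t)))
             (symUnimodal-*qInt (chainPolyF-symUnimodal s n u) (ρ t ∸ suc (ρ u)))
      where
      s≼u : s ≼ u
      s≼u = proj₁ (∈⋯⁻ u∈)

  Φinv : (Fin n → Fin n → Poly) → Fin n → (Fin n → Poly) → Fin n → Poly
  Φinv a s f t = byCases s t (constP -1ℤ) (λ j → ∑[ w ∈ s ⋯< t ] (f w *P a w t) j) 0P

  invDiagNegOne-unique : ∀ a s {X : Fin n → Poly} → (∀ t → X t ≗ Φinv a s X t) →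
                         ∀ t → invDiagNegOneF P n a s t ≗ X t
  invDiagNegOne-unique a s X-fixed t = LocalRecursion.iterate-unique
    (ℕ →-setoid ℤ) (Φinv a s) local (λ k → invDiagNegOneF P k a s) unfold X-fixed (#↓≤n t)
    where
    local : ∀ {f g} t → (∀ w → w ≺ t → f w ≗ g w) → Φinv a s f t ≗ Φinv a s g t
    local t f≗g j =
      byCases-cong-below s t (constP -1ℤ) 0P j (∑⋯<-cong (λ w _ w≺t → *P-congˡ (a w t) (f≗g w w≺t) j))
    unfold : ∀ k t → invDiagNegOneF P (suc k) a s t ≗ Φinv a s (invDiagNegOneF P k a s) t
    unfold k t j =
      byCases-cong-below s t (constP -1ℤ) 0P j (sumFin-cong (λ w → if-float (_$ j) (inIntervalCO P s w t)))

  -- the recursion by which invDiagNegOneF computes χ̄⁻¹ is solved by -chainPolySum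
  negChainPolySum-fixed : ∀ s t → (-P chainPolySum s t) ≗ Φinv (chiBar P) s (λ w → -P chainPolySum s w) t
  negChainPolySum-fixed s t j with compare s t
  ... | same = trans (cong -_ (chainPolySum-same j)) (trans (neg-constP1 j) (sym (cong (_$ j) (byCases-same {t = s}))))
    where
    neg-constP1 : ∀ j → - constP 1ℤ j ≡ constP -1ℤ j
    neg-constP1 zero    = refl
    neg-constP1 (suc j) = refl
  ... | below s≺t = begin
    - chainPolySum s t j
      ≡⟨ cong -_ (chainPolySum-χ̄ s≺t j) ⟨
    - ∑[ w ∈ s ⋯< t ] (chainPolySum s w *P chiBar P w t) j
      ≡⟨ ∑⟨⟩-neg (λ w → (chainPolySum s w *P chiBar P w t) j) ⟨
    ∑[ w ∈ s ⋯< t ] (- (chainPolySum s w *P chiBar P w t) j)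
      ≡⟨ ∑⋯<-cong (λ w _ _ → sym (*P-negˡ (chainPolySum s w) (chiBar P w t) j)) ⟩
    ∑[ w ∈ s ⋯< t ] ((-P chainPolySum s w) *P chiBar P w t) j
      ≡⟨ cong (_$ j) (byCases-below s≺t) ⟨
    Φinv (chiBar P) s (λ w → -P chainPolySum s w) t j
      ∎
    where open ≡-Reasoning
  ... | unrelated s⋠t =
    trans (cong -_ (∑⋯-empty (λ v → chainPoly s v j) s⋠t)) (sym (cong (_$ j) (byCases-unrelated s⋠t)))

  chowPoly≗chainPolySum : chowPoly P ≗ chainPolySum bot top
  chowPoly≗chainPolySum j =
    trans (cong -_ (invDiagNegOne-unique (chiBar P) bot (negChainPolySum-fixed bot) top j)) (ℤP.neg-involutive _)

  chowPoly-symUnimodal : ∃[ d ] SymUnimodal d (chowPoly P)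
  chowPoly-symUnimodal with chainPolySum-symUnimodal (bot-least top)
  ... | d , su = d , symUnimodal-≗ (sym ∘ chowPoly≗chainPolySum) su

theorem4p18 : (P : GradedBoundedPoset) → NonNegCoeffs (chowPoly P) × Unimodal (chowPoly P)
theorem4p18 P = symUnimodal⇒unimodal (proj₂ (Chow.chowPoly-symUnimodal P))
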